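{- For every composition $\alpha=[\alpha_1,\dots,\alpha_\ell]$ and every positive integer $k$, \[{\mathfrak S}_\alpha\Psi_k=\sum_{j=1}^{\ell}{\mathfrak S}_{[\alpha_1,\dots,\alpha_{j-1},\alpha_j+k,\alpha_{j+1},\dots,\alpha_\ell]}+\sum_{j=0}^{k-1}{\mathfrak S}_{[\alpha_1,\dots,\alpha_\ell,\underbrace{0,\dots,0}_{j},k]}.\]
   Context: Work over $\mathbb{Q}$. A composition is a finite sequence of positive integers. $\mathsf{NSym}$ is the free associative $\mathbb{Q}$-algebra on $H_1,H_2,\dots$ ($\deg H_i=i$); $H_{(a_1,\dots,a_m)}=H_{a_1}\cdots H_{a_m}$, $H_0=1$, $H_{ -r}=0$ for $r>0$. $\mathsf{QSym}$ has monomial basis $M_\alpha=\sum_{i_1<\dots<i_m}x_{i_1}^{\alpha_1}\cdots x_{i_m}^{\alpha_m}$, paired with $\mathsf{NSym}$ by $\langle H_\alpha,M_\beta\rangle=\delta_{\alpha,\beta}$; $F^\perp$ is defined by $\langle F^\perp H,G\rangle=\langle H,FG\rangle$ for all $G\in\mathsf{QSym}$. With $D(\alpha)=\{\alpha_1,\dots,\alpha_1+\dots+\alpha_{m-1}\}$ and $\alpha\le\beta$ iff $D(\beta)\subseteq D(\alpha)$, $F_\alpha=\sum_{\beta\le\alpha}M_\beta$, $F_{1^i}=F_{(1,\dots,1)}$ ($i$ ones, $F_{1^0}=1$). $\mathbb{B}_m=\sum_{i\ge0}(-1)^iH_{m+i}F_{1^i}^\perp$ (for any integer $m$), and for any integer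 tuple $\gamma=(\gamma_1,\dots,\gamma_r)\in\mathbb{Z}^r$ (zeros allowed), ${\mathfrak S}_\gamma=\mathbb{B}_{\gamma_1}\cdots\mathbb{B}_{\gamma_r}(1)$. The noncommutative power sums $\Psi_k$ (of the first kind, Gelfand–Krob–Lascoux–Leclerc–Retakh–Thibon) are defined by $\frac{d}{dt}\sigma(t)=\sigma(t)\psi(t)$ where $\sigma(t)=\sum_{n\ge0}H_nt^n$ and $\psi(t)=\sum_{k\ge1}\Psi_kt^{k-1}$; equivalently $\Psi_k=\sum_{i=0}^{k-1}(-1)^iR_{(1^i,k-i)}$, where $R_\beta=\sum_{\gamma\ge\beta}(-1)^{\ell(\beta)-\ell(\gamma)}H_\gamma$ are the ribbon functions. -}

module Defs where

open import Data.Nat as ℕ using (ℕ; zero; suc; _∸_; _<_)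
open import Data.Integer as ℤ using (ℤ; +_; -[1+_])
open import Data.Rational as ℚ using (ℚ; 0ℚ; 1ℚ)
open import Data.List using (List; []; _∷_; _++_; map; concatMap; replicate; length; upTo; allFin; updateAt; foldr)
open import Data.List.Properties using (≡-dec)
open import Data.Nat.ListAction using (sum)
open import Data.List.Relation.Unary.All using (All)
open import Data.Bool using (Bool; true; false; if_then_else_; _∧_; _∨_)
open import Data.Product using (_×_; _,_)
open import Relation.Nullary.Decidable using (⌊_⌋)
open import Relation.Binary.PropositionalEquality using (_≡_)

filterB : {A : Set} → (A → Bool) → List A → List A
filterB p []       = []
filterB p (x ∷ xs) = if p x then x ∷ filterB p xs else filterB p xs

IsComposition : List ℕ → Set
IsComposition α = All (λ a → 0 < a) α

weight : List ℕ → ℕ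
weight = sum

incHead : List ℕ → List ℕ
incHead []       = []
incHead (x ∷ xs) = suc x ∷ xs

comps : ℕ → List (List ℕ)
comps zero          = [] ∷ []
comps (suc zero)    = (1 ∷ []) ∷ []
comps (suc (suc n)) = map (1 ∷_) (comps (suc n)) ++ map incHead (comps (suc n))

D : List ℕ → List ℕ
D []           = []
D (a ∷ [])     = []
D (a ∷ b ∷ r)  = a ∷ map (a ℕ.+_) (D (b ∷ r))

memb : ℕ → List ℕ → Bool
memb x []       = false
memb x (y ∷ ys) = ⌊ x ℕ.≟ y ⌋ ∨ memb x ys

subsetB : List ℕ → List ℕ → Bool
subsetB []       ys = true
subsetB (x ∷ xs) ys = memb x ys ∧ subsetB xs ys

leqB : List ℕ → List ℕ → Bool
leqB α β = subsetB (D β) (D α)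

-- Formal ℚ-linear combinations of words (compositions).
-- Used both for NSym (word α ↦ H_α) and QSym (word α ↦ M_α).

Lin : Set
Lin = List (ℚ × List ℕ)

coeff : Lin → List ℕ → ℚ
coeff []            β = 0ℚ
coeff ((c , w) ∷ x) β = if ⌊ ≡-dec ℕ._≟_ w β ⌋ then c ℚ.+ coeff x β else coeff x β

_≈_ : Lin → Lin → Set
x ≈ y = ∀ β → coeff x β ≡ coeff y β

infix 4 _≈_

scale : ℚ → Lin → Lin
scale c = map (λ { (d , w) → (c ℚ.* d , w) })

ℤtoℚ : ℤ → ℚ
ℤtoℚ z = z ℚ./ 1

sgn : ℕ → ℚ
sgn zero    = 1ℚ
sgn (suc i) = ℚ.- sgn i

Σ : List Lin → Lin
Σ = foldr _++_ []

_·_ : Lin → Lin → Lin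
x · y = concatMap (λ { (c , u) → map (λ { (d , v) → (c ℚ.* d , u ++ v) }) y }) x

oneN : Lin
oneN = (1ℚ , []) ∷ []

-- H_m · (−), m ∈ ℤ, with H_0 = 1 and H_{-r} = 0
Hmul : ℤ → Lin → Lin
Hmul (+ zero)    x = x
Hmul (+ suc n)   x = map (λ { (c , w) → (c , suc n ∷ w) }) x
Hmul -[1+ n ]    x = []

-- QSym: monomial product M_α M_β = Σ over quasi-shuffles.

qsh : List ℕ → List ℕ → List (List ℕ)
qsh []       b        = b ∷ []
qsh (x ∷ a)  []       = (x ∷ a) ∷ []
qsh (x ∷ a)  (y ∷ b)  =
  map (x ∷_) (qsh a (y ∷ b)) ++ map (y ∷_) (qsh (x ∷ a) b) ++ map ((x ℕ.+ y) ∷_) (qsh a b)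

_⋆_ : Lin → Lin → Lin
G ⋆ G' = concatMap (λ { (c , u) → concatMap (λ { (d , v) → map (λ w → (c ℚ.* d , w)) (qsh u v) }) G' }) G

F : List ℕ → Lin
F α = map (λ β → (1ℚ , β)) (filterB (λ β → leqB β α) (comps (weight α)))

M : List ℕ → Lin
M γ = (1ℚ , γ) ∷ []

pairH : List ℕ → Lin → ℚ
pairH α G = coeff G α

-- G^⊥ for G ∈ QSym homogeneous of degree d, on the basis element H_α:
-- G^⊥ H_α = Σ_γ ⟨H_α , G M_γ⟩ H_γ (only γ ⊨ |α| − d can contribute).
perpBasis : ℕ → Lin → List ℕ → Lin
perpBasis d G α = map (λ γ → (pairH α (G ⋆ M γ) , γ)) (comps (weight α ∸ d))

perp : ℕ → Lin → Lin → Lin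
perp d G x = concatMap (λ { (c , α) → scale c (perpBasis d G α) }) x

-- 𝔹_m = Σ_{i ≥ 0} (−1)^i H_{m+i} F_{1^i}^⊥.
-- On H_α, F_{1^i}^⊥ H_α = 0 for i > |α|, so the sum is finite.

BBasis : ℤ → List ℕ → Lin
BBasis m α = Σ (map (λ i → scale (sgn i) (Hmul (m ℤ.+ + i) (perp i (F (replicate i 1)) ((1ℚ , α) ∷ []))))
                    (upTo (suc (weight α))))

𝔹 : ℤ → Lin → Lin
𝔹 m x = concatMap (λ { (c , α) → scale c (BBasis m α) }) x

𝔖 : List ℤ → Lin
𝔖 γ = foldr 𝔹 oneN γ

R : List ℕ → Lin
R β = map (λ γ → (sgn (length β ∸ length γ) , γ)) (filterB (λ γ → leqB β γ) (comps (weight β)))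

Ψ : ℕ → Lin
Ψ k = Σ (map (λ i → scale (sgn i) (R (replicate i 1 ++ (k ∸ i ∷ [])))) (upTo k))

toℤ : List ℕ → List ℤ
toℤ = map +_

-- Write ∂ᵢ for F_{1^i}^⊥. On the H-basis, ∂ᵢ H_α is the sum of the H_β where β arises from α
-- by lowering i distinct parts by one (deleting parts that reach 0); hence ∂ᵢ obeys the Leibniz
-- rule ∂ᵢ(G Y) = Σ_{a+b=i} ∂ₐG ∂_bY, and 𝔹_m G = Σᵢ (−1)^i H_{m+i} ∂ᵢG.
-- Expanding Ψ_k = Σ_{j<k} (−1)^j R_{(1^j,k−j)} as a sum of hooks Σ_{p≤j} Λ_p H_{k−p}, where
-- Λ_p = (−1)^p e_p, one finds ∂_b Ψ_k = 0 for 0 < b ≠ k and ∂_k Ψ_k = (−1)^{k−1}. The Leibniz rule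
-- then gives 𝔹_m(G) Ψ_k = 𝔹_m(G Ψ_k) + 𝔹_{m+k}(G), and induction on α produces the first sum.
-- The second sum is the base case: the j-th hook of Ψ_k is 𝔖_{(0^j,k)}.

module Submission where

open import Defs
open import Data.Nat as ℕ using (ℕ; zero; suc; _≤_; _<_; z≤n; s≤s; _∸_; _+_)
import Data.Nat.Properties as ℕP
open import Data.Nat.ListAction.Properties using (sum-++)
open import Data.Integer as ℤ using (ℤ; +_; -[1+_])
import Data.Integer.Properties as ℤP
open import Data.Rational as Q using (ℚ; 0ℚ; 1ℚ) renaming (_+_ to _+q_; _*_ to _*q_; -_ to -q_)
open import Algebra.Bundles using (CommutativeMonoid)
import Data.Rational.Properties as QP
open import Algebra.Properties.CommutativeSemigroup (CommutativeMonoid.commutativeSemigroup QP.+-0-commutativeMonoid)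
  using () renaming (interchange to +q-interchange)
open import Algebra.Properties.CommutativeSemigroup (CommutativeMonoid.commutativeSemigroup QP.*-1-commutativeMonoid)
  using () renaming (x∙yz≈y∙xz to *q-swap)
open import Algebra.Properties.Group QP.+-0-group using () renaming (⁻¹-involutive to neg-involutive)
open import Data.Fin using (Fin; zero; suc)
open import Data.List using (List; []; _∷_; _++_; map; deduplicate; replicate; length; upTo; applyUpTo; allFin; updateAt; tabulate)
import Data.List.Properties as LP
open import Data.List.Properties using (≡-dec)
open import Data.List.Relation.Unary.All as All using (All; []; _∷_)
import Data.List.Relation.Unary.All.Properties as AllP
open import Data.List.Relation.Unary.Any using (here; there)
open import Data.List.Membership.Propositional using (_∈_)
open import Data.List.Membership.Propositional.Properties using (∈-deduplicate⁺; ∈-++⁺ˡ; ∈-++⁺ʳ)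
open import Data.List.Relation.Unary.Unique.Propositional using (Unique)
open import Data.List.Relation.Unary.AllPairs.Core using ([]; _∷_)
open import Data.List.Relation.Unary.Unique.DecPropositional.Properties (≡-dec ℕ._≟_) using (deduplicate-!)
open import Data.Bool using (Bool; true; false; if_then_else_; _∧_; _∨_)
open import Data.Product using (_×_; _,_; proj₂)
open import Data.Sum using (_⊎_; inj₁; inj₂)
open import Data.Empty using (⊥-elim)
open import Relation.Nullary using (yes; no; ¬_; Dec)
open import Relation.Nullary.Decidable using (⌊_⌋)
open import Relation.Binary using (Setoid)
open import Relation.Binary.PropositionalEquality
import Relation.Binary.Reasoning.Setoid

sameWord : List ℕ → List ℕ → Bool
sameWord w β = ⌊ ≡-dec ℕ._≟_ w β ⌋

true≢false : true ≢ false
true≢false ()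

𝟙 : Bool → ℚ
𝟙 true = 1ℚ
𝟙 false = 0ℚ

coeff-cons : ∀ c w x β → coeff ((c , w) ∷ x) β ≡ 𝟙 (sameWord w β) *q c +q coeff x β
coeff-cons c w x β with ≡-dec ℕ._≟_ w β
... | yes _ = cong (_+q coeff x β) (sym (QP.*-identityˡ c))
... | no _ = sym (trans (cong (_+q coeff x β) (QP.*-zeroˡ c)) (QP.+-identityˡ _))

coeff-++ : ∀ x y β → coeff (x ++ y) β ≡ coeff x β +q coeff y β
coeff-++ [] y β = sym (QP.+-identityˡ _)
coeff-++ ((c , w) ∷ x) y β = begin
  coeff ((c , w) ∷ (x ++ y)) β ≡⟨ coeff-cons c w (x ++ y) β ⟩
  𝟙 (sameWord w β) *q c +q coeff (x ++ y) β ≡⟨ cong (𝟙 (sameWord w β) *q c +q_) (coeff-++ x y β) ⟩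
  𝟙 (sameWord w β) *q c +q (coeff x β +q coeff y β) ≡⟨ sym (QP.+-assoc (𝟙 (sameWord w β) *q c) (coeff x β) (coeff y β)) ⟩
  (𝟙 (sameWord w β) *q c +q coeff x β) +q coeff y β ≡⟨ cong (_+q coeff y β) (sym (coeff-cons c w x β)) ⟩
  coeff ((c , w) ∷ x) β +q coeff y β ∎
  where open ≡-Reasoning

coeff-scale : ∀ c x β → coeff (scale c x) β ≡ c *q coeff x β
coeff-scale c [] β = sym (QP.*-zeroʳ c)
coeff-scale c ((d , w) ∷ x) β = begin
  coeff ((c *q d , w) ∷ scale c x) β ≡⟨ coeff-cons (c *q d) w (scale c x) β ⟩
  𝟙 (sameWord w β) *q (c *q d) +q coeff (scale c x) β ≡⟨ cong₂ _+q_ (*q-swap (𝟙 (sameWord w β)) c d) (coeff-scale c x β) ⟩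
  c *q (𝟙 (sameWord w β) *q d) +q c *q coeff x β ≡⟨ sym (QP.*-distribˡ-+ c _ _) ⟩
  c *q (𝟙 (sameWord w β) *q d +q coeff x β) ≡⟨ cong (c *q_) (sym (coeff-cons d w x β)) ⟩
  c *q coeff ((d , w) ∷ x) β ∎
  where open ≡-Reasoning

-- A record, so that both sides can be recovered from a proof during unification.
infix 4 _≋_
record _≋_ (x y : Lin) : Set where
  constructor mk≋
  field get : x ≈ y
open _≋_ public

≋-refl : ∀ {x} → x ≋ x
≋-refl = mk≋ (λ β → refl)
≋-sym : ∀ {x y} → x ≋ y → y ≋ x
≋-sym (mk≋ p) = mk≋ (λ β → sym (p β))
≋-trans : ∀ {x y z} → x ≋ y → y ≋ z → x ≋ z
≋-trans (mk≋ p) (mk≋ q) = mk≋ (λ β → trans (p β) (q β))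
≡⇒≋ : ∀ {x y} → x ≡ y → x ≋ y
≡⇒≋ refl = ≋-refl

Lin-setoid : Setoid _ _
Lin-setoid = record { Carrier = Lin ; _≈_ = _≋_ ; isEquivalence = record { refl = ≋-refl ; sym = ≋-sym ; trans = ≋-trans } }

++-cong : ∀ {x x' y y'} → x ≋ x' → y ≋ y' → x ++ y ≋ x' ++ y'
++-cong {x} {x'} {y} {y'} (mk≋ p) (mk≋ q) = mk≋ λ β → trans (coeff-++ x y β) (trans (cong₂ _+q_ (p β) (q β)) (sym (coeff-++ x' y' β)))

++-congˡ : ∀ {x x'} y → x ≋ x' → x ++ y ≋ x' ++ y
++-congˡ y p = ++-cong p ≋-refl
++-congʳ : ∀ x {y y'} → y ≋ y' → x ++ y ≋ x ++ y'
++-congʳ x p = ++-cong ≋-refl p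

++-comm≋ : ∀ x y → x ++ y ≋ y ++ x
++-comm≋ x y = mk≋ λ β → trans (coeff-++ x y β) (trans (QP.+-comm (coeff x β) (coeff y β)) (sym (coeff-++ y x β)))

++-assoc≋ : ∀ x y z → (x ++ y) ++ z ≋ x ++ (y ++ z)
++-assoc≋ x y z = ≡⇒≋ (LP.++-assoc x y z)

++-interchange : ∀ a b c d → (a ++ b) ++ (c ++ d) ≋ (a ++ c) ++ (b ++ d)
++-interchange a b c d = mk≋ λ β → trans (coeff-++ (a ++ b) (c ++ d) β)
  (trans (cong₂ _+q_ (coeff-++ a b β) (coeff-++ c d β))
  (trans (+q-interchange (coeff a β) (coeff b β) (coeff c β) (coeff d β))
  (sym (trans (coeff-++ (a ++ c) (b ++ d) β) (cong₂ _+q_ (coeff-++ a c β) (coeff-++ b d β))))))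

++-identityʳ-≋ : ∀ x → x ++ [] ≋ x
++-identityʳ-≋ x = ≡⇒≋ (LP.++-identityʳ x)

scale-cong : ∀ c {x y} → x ≋ y → scale c x ≋ scale c y
scale-cong c {x} {y} (mk≋ p) = mk≋ λ β → trans (coeff-scale c x β) (trans (cong (c *q_) (p β)) (sym (coeff-scale c y β)))

scale-++ : ∀ c x y → scale c (x ++ y) ≡ scale c x ++ scale c y
scale-++ c x y = LP.map-++ _ x y

scale-scale : ∀ c d x → scale c (scale d x) ≋ scale (c *q d) x
scale-scale c d x = mk≋ λ β → trans (coeff-scale c (scale d x) β) (trans (cong (c *q_) (coeff-scale d x β))
  (trans (sym (QP.*-assoc c d (coeff x β))) (sym (coeff-scale (c *q d) x β))))

scale-1 : ∀ x → scale 1ℚ x ≋ x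
scale-1 x = mk≋ λ β → trans (coeff-scale 1ℚ x β) (QP.*-identityˡ (coeff x β))

++-inverseʳ : ∀ x → x ++ scale (-q 1ℚ) x ≋ []
++-inverseʳ x = mk≋ λ β → trans (coeff-++ x (scale (-q 1ℚ) x) β) (trans (cong (coeff x β +q_) (coeff-scale (-q 1ℚ) x β))
  (trans (cong (coeff x β +q_) (sym (QP.neg-distribˡ-* 1ℚ (coeff x β))))
  (trans (cong (λ z → coeff x β +q (-q z)) (QP.*-identityˡ (coeff x β))) (QP.+-inverseʳ (coeff x β)))))

module ≋R = Relation.Binary.Reasoning.Setoid Lin-setoid

≋-moveʳ : ∀ x y z → x ≋ y ++ scale (-q 1ℚ) z → x ++ z ≋ y
≋-moveʳ x y z p = begin
  x ++ z ≈⟨ ++-congˡ z p ⟩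
  (y ++ scale (-q 1ℚ) z) ++ z ≈⟨ ++-assoc≋ y _ z ⟩
  y ++ (scale (-q 1ℚ) z ++ z) ≈⟨ ++-congʳ y (++-comm≋ _ z) ⟩
  y ++ (z ++ scale (-q 1ℚ) z) ≈⟨ ++-congʳ y (++-inverseʳ z) ⟩
  y ++ [] ≈⟨ ++-identityʳ-≋ y ⟩
  y ∎
  where open ≋R

sameWord-refl : ∀ w → sameWord w w ≡ true
sameWord-refl w with ≡-dec ℕ._≟_ w w
... | yes _ = refl
... | no ¬p = ⊥-elim (¬p refl)

sameWord-≢ : ∀ {w v} → ¬ w ≡ v → sameWord w v ≡ false
sameWord-≢ {w} {v} neq with ≡-dec ℕ._≟_ w v
... | yes p = ⊥-elim (neq p)
... | no _ = refl

extend : (List ℕ → Lin) → Lin → Lin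
extend f [] = []
extend f ((c , α) ∷ x) = scale c (f α) ++ extend f x

extend-++ : ∀ f x y → extend f (x ++ y) ≡ extend f x ++ extend f y
extend-++ f [] y = refl
extend-++ f ((c , α) ∷ x) y = trans (cong (scale c (f α) ++_) (extend-++ f x y))
  (sym (LP.++-assoc (scale c (f α)) (extend f x) (extend f y)))

extend-pointwise : ∀ {f g} x → (∀ α → f α ≋ g α) → extend f x ≋ extend g x
extend-pointwise [] p = ≋-refl
extend-pointwise ((c , α) ∷ x) p = ++-cong (scale-cong c (p α)) (extend-pointwise x p)

evaluate : Lin → (List ℕ → ℚ) → ℚ
evaluate [] g = 0ℚ
evaluate ((c , α) ∷ x) g = c *q g α +q evaluate x g

coeff-extend : ∀ f x β → coeff (extend f x) β ≡ evaluate x (λ α → coeff (f α) β)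
coeff-extend f [] β = refl
coeff-extend f ((c , α) ∷ x) β = trans (coeff-++ (scale c (f α)) (extend f x) β)
  (cong₂ _+q_ (coeff-scale c (f α) β) (coeff-extend f x β))

sumOver : List (List ℕ) → (List ℕ → ℚ) → ℚ
sumOver [] h = 0ℚ
sumOver (α ∷ W) h = h α +q sumOver W h

sumOver-cong : ∀ W {h h'} → (∀ α → h α ≡ h' α) → sumOver W h ≡ sumOver W h'
sumOver-cong [] p = refl
sumOver-cong (α ∷ W) p = cong₂ _+q_ (p α) (sumOver-cong W p)

sumOver-+ : ∀ W h h' → sumOver W (λ α → h α +q h' α) ≡ sumOver W h +q sumOver W h'
sumOver-+ [] h h' = sym (QP.+-identityʳ 0ℚ)
sumOver-+ (α ∷ W) h h' = trans (cong (h α +q h' α +q_) (sumOver-+ W h h')) (+q-interchange (h α) (h' α) (sumOver W h) (sumOver W h'))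

sumOver-zero : ∀ W → sumOver W (λ α → 0ℚ) ≡ 0ℚ
sumOver-zero [] = refl
sumOver-zero (α ∷ W) = trans (QP.+-identityˡ _) (sumOver-zero W)

sumOver-absent : ∀ W w (g : List ℕ → ℚ) → All (λ v → ¬ w ≡ v) W → sumOver W (λ α → 𝟙 (sameWord w α) *q g α) ≡ 0ℚ
sumOver-absent [] w g [] = refl
sumOver-absent (v ∷ W) w g (neq ∷ nes) = trans (cong₂ _+q_ (trans (cong (λ b → 𝟙 b *q g v) (sameWord-≢ neq)) (QP.*-zeroˡ (g v))) (sumOver-absent W w g nes)) (QP.+-identityˡ 0ℚ)

sumOver-single : ∀ W w (g : List ℕ → ℚ) → Unique W → w ∈ W → sumOver W (λ α → 𝟙 (sameWord w α) *q g α) ≡ g w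
sumOver-single (v ∷ W) w g (nv ∷ u) (here refl) =
  trans (cong₂ _+q_ (trans (cong (λ b → 𝟙 b *q g w) (sameWord-refl w)) (QP.*-identityˡ (g w))) (sumOver-absent W w g (All.map (λ neq e → neq e) nv))) (QP.+-identityʳ (g w))
sumOver-single (v ∷ W) w g (nv ∷ u) (there m) =
  trans (cong₂ _+q_ (trans (cong (λ b → 𝟙 b *q g v) (sameWord-≢ (λ e → All.lookup nv (subst (_∈ W) e m) refl))) (QP.*-zeroˡ (g v))) (sumOver-single W w g u m)) (QP.+-identityˡ (g w))

support : Lin → List (List ℕ)
support = map proj₂

evaluate-sumOver : ∀ x g W → Unique W → All (_∈ W) (support x) → evaluate x g ≡ sumOver W (λ α → coeff x α *q g α)
evaluate-sumOver [] g W u a = sym (trans (sumOver-cong W (λ α → QP.*-zeroˡ (g α))) (sumOver-zero W))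
evaluate-sumOver ((c , w) ∷ x) g W u (m ∷ a) = sym (begin
  sumOver W (λ α → coeff ((c , w) ∷ x) α *q g α)
    ≡⟨ sumOver-cong W (λ α → trans (cong (_*q g α) (coeff-cons c w x α)) (QP.*-distribʳ-+ (g α) (𝟙 (sameWord w α) *q c) (coeff x α))) ⟩
  sumOver W (λ α → 𝟙 (sameWord w α) *q c *q g α +q coeff x α *q g α) ≡⟨ sumOver-+ W _ _ ⟩
  sumOver W (λ α → 𝟙 (sameWord w α) *q c *q g α) +q sumOver W (λ α → coeff x α *q g α)
    ≡⟨ cong₂ _+q_ (trans (sumOver-cong W (λ α → QP.*-assoc (𝟙 (sameWord w α)) c (g α))) (sumOver-single W w (λ α → c *q g α) u m))
                  (sym (evaluate-sumOver x g W u a)) ⟩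
  c *q g w +q evaluate x g ∎)
  where open ≡-Reasoning

extend-cong : ∀ f {x y} → x ≋ y → extend f x ≋ extend f y
extend-cong f {x} {y} (mk≋ p) = mk≋ λ β → begin
  coeff (extend f x) β ≡⟨ coeff-extend f x β ⟩
  evaluate x (coeffOf β) ≡⟨ evaluate-sumOver x (coeffOf β) W W-unique (All.tabulate (λ m → ∈-deduplicate⁺ (≡-dec ℕ._≟_) (∈-++⁺ˡ m))) ⟩
  sumOver W (λ α → coeff x α *q coeffOf β α) ≡⟨ sumOver-cong W (λ α → cong (_*q coeffOf β α) (p α)) ⟩
  sumOver W (λ α → coeff y α *q coeffOf β α)
    ≡⟨ sym (evaluate-sumOver y (coeffOf β) W W-unique (All.tabulate (λ m → ∈-deduplicate⁺ (≡-dec ℕ._≟_) (∈-++⁺ʳ (support x) m)))) ⟩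
  evaluate y (coeffOf β) ≡⟨ sym (coeff-extend f y β) ⟩
  coeff (extend f y) β ∎
  where
  open ≡-Reasoning
  coeffOf : List ℕ → List ℕ → ℚ
  coeffOf β α = coeff (f α) β
  W = deduplicate (≡-dec ℕ._≟_) (support x ++ support y)
  W-unique : Unique W
  W-unique = deduplicate-! (support x ++ support y)

extend-scale : ∀ f c x → extend f (scale c x) ≋ scale c (extend f x)
extend-scale f c [] = ≋-refl
extend-scale f c ((d , α) ∷ x) = ≋-trans (++-cong (≋-sym (scale-scale c d (f α))) (extend-scale f c x))
  (≡⇒≋ (sym (scale-++ c (scale d (f α)) (extend f x))))

extend-single : ∀ f α → extend f ((1ℚ , α) ∷ []) ≋ f α
extend-single f α = ≋-trans (++-identityʳ-≋ _) (scale-1 (f α))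

extend-zero : ∀ x → extend (λ _ → []) x ≋ []
extend-zero [] = ≋-refl
extend-zero ((c , α) ∷ x) = extend-zero x

extend-extend : ∀ f g x → extend f (extend g x) ≋ extend (λ α → extend f (g α)) x
extend-extend f g [] = ≋-refl
extend-extend f g ((c , α) ∷ x) = ≋-trans (≡⇒≋ (extend-++ f (scale c (g α)) (extend g x)))
  (++-cong (extend-scale f c (g α)) (extend-extend f g x))

sameWord-sym : ∀ w v → sameWord w v ≡ sameWord v w
sameWord-sym w v with ≡-dec ℕ._≟_ w v | ≡-dec ℕ._≟_ v w
... | yes _ | yes _ = refl
... | no _ | no _ = refl
... | yes p | no q = ⊥-elim (q (sym p))
... | no p | yes q = ⊥-elim (p (sym q))

sameWord-≡ : ∀ {w v} → w ≡ v → sameWord w v ≡ true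
sameWord-≡ {w} refl = sameWord-refl w

sameWord-∷ : ∀ a w v → sameWord (a ∷ w) (a ∷ v) ≡ sameWord w v
sameWord-∷ a w v = by-dec (≡-dec ℕ._≟_ w v)
  where
  by-dec : Dec (w ≡ v) → sameWord (a ∷ w) (a ∷ v) ≡ sameWord w v
  by-dec (yes p) = trans (sameWord-≡ (cong (a ∷_) p)) (sym (sameWord-≡ p))
  by-dec (no neq) = trans (sameWord-≢ (λ e → neq (LP.∷-injectiveʳ e))) (sym (sameWord-≢ neq))

sameWord-∷-≢ : ∀ a b w v → ¬ a ≡ b → sameWord (a ∷ w) (b ∷ v) ≡ false
sameWord-∷-≢ a b w v neq = sameWord-≢ (λ e → neq (LP.∷-injectiveˡ e))

count : List ℕ → List (List ℕ) → ℚ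
count γ [] = 0ℚ
count γ (w ∷ L) = 𝟙 (sameWord w γ) +q count γ L

fromWords : List (List ℕ) → Lin
fromWords = map (λ w → (1ℚ , w))

coeff-fromWords : ∀ L γ → coeff (fromWords L) γ ≡ count γ L
coeff-fromWords [] γ = refl
coeff-fromWords (w ∷ L) γ = trans (coeff-cons 1ℚ w (fromWords L) γ) (cong₂ _+q_ (QP.*-identityʳ (𝟙 (sameWord w γ))) (coeff-fromWords L γ))

count-++ : ∀ γ L L' → count γ (L ++ L') ≡ count γ L +q count γ L'
count-++ γ [] L' = sym (QP.+-identityˡ (count γ L'))
count-++ γ (w ∷ L) L' = trans (cong (𝟙 (sameWord w γ) +q_) (count-++ γ L L')) (sym (QP.+-assoc (𝟙 (sameWord w γ)) (count γ L) (count γ L')))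

count-absent : ∀ γ L → All (λ w → ¬ w ≡ γ) L → count γ L ≡ 0ℚ
count-absent γ [] [] = refl
count-absent γ (w ∷ L) (neq ∷ a) = trans (cong₂ _+q_ (cong 𝟙 (sameWord-≢ neq)) (count-absent γ L a)) (QP.+-identityˡ 0ℚ)

count-∷-same : ∀ a v L → count (a ∷ v) (map (a ∷_) L) ≡ count v L
count-∷-same a v [] = refl
count-∷-same a v (w ∷ L) = cong₂ _+q_ (cong 𝟙 (sameWord-∷ a w v)) (count-∷-same a v L)

count-∷-≢ : ∀ a b v L → ¬ a ≡ b → count (b ∷ v) (map (a ∷_) L) ≡ 0ℚ
count-∷-≢ a b v [] neq = refl
count-∷-≢ a b v (w ∷ L) neq = trans (cong₂ _+q_ (cong 𝟙 (sameWord-∷-≢ a b w v neq)) (count-∷-≢ a b v L neq)) (QP.+-identityˡ 0ℚ)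

count-[]-∷ : ∀ a L → count [] (map (a ∷_) L) ≡ 0ℚ
count-[]-∷ a [] = refl
count-[]-∷ a (w ∷ L) = trans (QP.+-identityˡ (count [] (map (a ∷_) L))) (count-[]-∷ a L)

sameℕ : ℕ → ℕ → Bool
sameℕ a b = ⌊ a ℕ.≟ b ⌋

count-∷ : ∀ a b v L → count (b ∷ v) (map (a ∷_) L) ≡ 𝟙 (sameℕ a b) *q count v L
count-∷ a b v L with a ℕ.≟ b
... | yes refl = trans (count-∷-same a v L) (sym (QP.*-identityˡ (count v L)))
... | no neq = trans (count-∷-≢ a b v L neq) (sym (QP.*-zeroˡ (count v L)))

count-[]-incHead : ∀ L → count [] (map incHead L) ≡ count [] L
count-[]-incHead [] = refl
count-[]-incHead ([] ∷ L) = cong (1ℚ +q_) (count-[]-incHead L)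
count-[]-incHead ((x ∷ w) ∷ L) = cong (0ℚ +q_) (count-[]-incHead L)

count-0-incHead : ∀ v L → count (0 ∷ v) (map incHead L) ≡ 0ℚ
count-0-incHead v [] = refl
count-0-incHead v ([] ∷ L) = trans (QP.+-identityˡ (count (0 ∷ v) (map incHead L))) (count-0-incHead v L)
count-0-incHead v ((x ∷ w) ∷ L) = trans (cong₂ _+q_ (cong 𝟙 (sameWord-∷-≢ (suc x) 0 w v (λ ()))) (count-0-incHead v L)) (QP.+-identityˡ 0ℚ)

count-suc-incHead : ∀ b v L → count (suc b ∷ v) (map incHead L) ≡ count (b ∷ v) L
count-suc-incHead b v [] = refl
count-suc-incHead b v ([] ∷ L) = cong (0ℚ +q_) (count-suc-incHead b v L)
count-suc-incHead b v ((x ∷ w) ∷ L) = cong₂ _+q_ (cong 𝟙 (sameWord-suc x)) (count-suc-incHead b v L)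
  where
  sameWord-suc : ∀ x → sameWord (suc x ∷ w) (suc b ∷ v) ≡ sameWord (x ∷ w) (b ∷ v)
  sameWord-suc x = by-dec (x ℕ.≟ b)
    where
    by-dec : Dec (x ≡ b) → sameWord (suc x ∷ w) (suc b ∷ v) ≡ sameWord (x ∷ w) (b ∷ v)
    by-dec (yes refl) = trans (sameWord-∷ (suc x) w v) (sym (sameWord-∷ x w v))
    by-dec (no neq) = trans (sameWord-∷-≢ (suc x) (suc b) w v (λ e → neq (ℕP.suc-injective e))) (sym (sameWord-∷-≢ x b w v neq))

allPositive : List ℕ → Bool
allPositive [] = true
allPositive (zero ∷ w) = false
allPositive (suc a ∷ w) = allPositive w

isCompositionOf : ℕ → List ℕ → Bool
isCompositionOf zero [] = true
isCompositionOf (suc m) [] = false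
isCompositionOf m (zero ∷ v) = false
isCompositionOf zero (suc b ∷ v) = false
isCompositionOf (suc m) (suc zero ∷ v) = isCompositionOf m v
isCompositionOf (suc m) (suc (suc b) ∷ v) = isCompositionOf m (suc b ∷ v)

count-comps : ∀ n γ → count γ (comps n) ≡ 𝟙 (isCompositionOf n γ)
count-comps zero [] = refl
count-comps zero (zero ∷ v) = refl
count-comps zero (suc b ∷ v) = refl
count-comps (suc zero) [] = refl
count-comps (suc zero) (zero ∷ v) = trans (QP.+-identityʳ (𝟙 (sameWord (1 ∷ []) (0 ∷ v)))) (cong 𝟙 (sameWord-∷-≢ 1 0 [] v (λ ())))
count-comps (suc zero) (suc zero ∷ v) = trans (QP.+-identityʳ (𝟙 (sameWord (1 ∷ []) (1 ∷ v)))) (trans (cong 𝟙 (sameWord-∷ 1 [] v)) (sameWord-[] v))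
  where
  sameWord-[] : ∀ v → 𝟙 (sameWord [] v) ≡ 𝟙 (isCompositionOf 0 v)
  sameWord-[] [] = refl
  sameWord-[] (zero ∷ v) = refl
  sameWord-[] (suc x ∷ v) = refl
count-comps (suc zero) (suc (suc b) ∷ v) = trans (QP.+-identityʳ (𝟙 (sameWord (1 ∷ []) (suc (suc b) ∷ v)))) (cong 𝟙 (sameWord-∷-≢ 1 (suc (suc b)) [] v (λ ())))
count-comps (suc (suc n)) [] = trans (count-++ [] (map (1 ∷_) (comps (suc n))) (map incHead (comps (suc n))))
  (trans (cong₂ _+q_ (count-[]-∷ 1 (comps (suc n))) (trans (count-[]-incHead (comps (suc n))) (count-comps (suc n) []))) (QP.+-identityˡ 0ℚ))
count-comps (suc (suc n)) (zero ∷ v) = trans (count-++ (zero ∷ v) (map (1 ∷_) (comps (suc n))) (map incHead (comps (suc n))))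
  (trans (cong₂ _+q_ (count-∷-≢ 1 0 v (comps (suc n)) (λ ())) (count-0-incHead v (comps (suc n)))) (QP.+-identityˡ 0ℚ))
count-comps (suc (suc n)) (suc zero ∷ v) = trans (count-++ (1 ∷ v) (map (1 ∷_) (comps (suc n))) (map incHead (comps (suc n))))
  (trans (cong₂ _+q_ (trans (count-∷-same 1 v (comps (suc n))) (count-comps (suc n) v))
                     (trans (count-suc-incHead 0 v (comps (suc n))) (count-comps (suc n) (0 ∷ v))))
         (QP.+-identityʳ (𝟙 (isCompositionOf (suc n) v))))
count-comps (suc (suc n)) (suc (suc b) ∷ v) = trans (count-++ (suc (suc b) ∷ v) (map (1 ∷_) (comps (suc n))) (map incHead (comps (suc n))))
  (trans (cong₂ _+q_ (count-∷-≢ 1 (suc (suc b)) v (comps (suc n)) (λ ()))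
                     (trans (count-suc-incHead (suc b) v (comps (suc n))) (count-comps (suc n) (suc b ∷ v))))
         (QP.+-identityˡ (𝟙 (isCompositionOf (suc n) (suc b ∷ v)))))

comps-sound : ∀ n → All (λ β → isCompositionOf n β ≡ true) (comps n)
comps-sound zero = refl ∷ []
comps-sound (suc zero) = refl ∷ []
comps-sound (suc (suc n)) = AllP.++⁺ (AllP.map⁺ (comps-sound (suc n))) (AllP.map⁺ (All.map (λ {β} → incHead-sound {β}) (comps-sound (suc n))))
  where
  incHead-sound : ∀ {β} → isCompositionOf (suc n) β ≡ true → isCompositionOf (suc (suc n)) (incHead β) ≡ true
  incHead-sound {suc b ∷ v} p = p

⌊≟⌋-suc : ∀ x y → ⌊ suc x ℕ.≟ suc y ⌋ ≡ ⌊ x ℕ.≟ y ⌋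
⌊≟⌋-suc x y with x ℕ.≟ y | suc x ℕ.≟ suc y
... | yes _ | yes _ = refl
... | no _  | no _  = refl
... | yes p | no q  = ⊥-elim (q (cong suc p))
... | no p  | yes q = ⊥-elim (p (ℕP.suc-injective q))

-- F_{1^i} = M_{1^i}

filterB-++ : ∀ {A : Set} (p : A → Bool) xs ys → filterB p (xs ++ ys) ≡ filterB p xs ++ filterB p ys
filterB-++ p [] ys = refl
filterB-++ p (x ∷ xs) ys with p x
... | true = cong (x ∷_) (filterB-++ p xs ys)
... | false = filterB-++ p xs ys

filterB-map : ∀ {A B : Set} (p : B → Bool) (f : A → B) xs → filterB p (map f xs) ≡ map f (filterB (λ x → p (f x)) xs)
filterB-map p f [] = refl
filterB-map p f (x ∷ xs) with p (f x)
... | true = cong (f x ∷_) (filterB-map p f xs)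
... | false = filterB-map p f xs

filterB-cong : ∀ {A : Set} {p q : A → Bool} {xs} → All (λ x → p x ≡ q x) xs → filterB p xs ≡ filterB q xs
filterB-cong [] = refl
filterB-cong {p = p} {q} {x ∷ xs} (e ∷ es) with p x | q x
... | true | true = cong (x ∷_) (filterB-cong es)
... | false | false = filterB-cong es
filterB-cong {p = p} {q} {x ∷ xs} (() ∷ es) | true | false
filterB-cong {p = p} {q} {x ∷ xs} (() ∷ es) | false | true

filterB-none : ∀ {A : Set} {p : A → Bool} {xs} → All (λ x → p x ≡ false) xs → filterB p xs ≡ []
filterB-none [] = refl
filterB-none {p = p} {x ∷ xs} (e ∷ es) with p x
filterB-none {p = p} {x ∷ xs} (() ∷ es) | true
... | false = filterB-none es

memb-suc : ∀ x Y → memb (suc x) (map suc Y) ≡ memb x Y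
memb-suc x [] = refl
memb-suc x (y ∷ Y) = cong₂ _∨_ (⌊≟⌋-suc x y) (memb-suc x Y)

memb-0 : ∀ Y → All (0 <_) Y → memb 0 Y ≡ false
memb-0 [] [] = refl
memb-0 (suc y ∷ Y) (s≤s z≤n ∷ a) = memb-0 Y a

subset-shift : ∀ X Y → All (0 <_) X → subsetB (map suc X) (1 ∷ map suc Y) ≡ subsetB X Y
subset-shift [] Y [] = refl
subset-shift (suc x ∷ X) Y (s≤s z≤n ∷ a) = cong₂ _∧_ (memb-suc (suc x) Y) (subset-shift X Y a)

All-positive-+ : ∀ a Y → All (0 <_) (map (suc a ℕ.+_) Y)
All-positive-+ a [] = []
All-positive-+ a (y ∷ Y) = s≤s z≤n ∷ All-positive-+ a Y

D-ones-positive : ∀ m → All (0 <_) (D (replicate m 1))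
D-ones-positive zero = []
D-ones-positive (suc zero) = []
D-ones-positive (suc (suc m)) = s≤s z≤n ∷ All-positive-+ 0 (D (replicate (suc m) 1))

D-positive : ∀ a r → All (0 <_) (D (suc a ∷ r))
D-positive a [] = []
D-positive a (b ∷ r) = s≤s z≤n ∷ All-positive-+ a (D (b ∷ r))

D-incHead : ∀ b r → D (incHead (b ∷ r)) ≡ map suc (D (b ∷ r))
D-incHead b [] = refl
D-incHead b (c ∷ r) = cong (suc b ∷_) (LP.map-∘ {g = suc} {f = b ℕ.+_} (D (c ∷ r)))

leqB-1∷-ones : ∀ n b r → leqB (1 ∷ b ∷ r) (replicate (suc (suc n)) 1) ≡ leqB (b ∷ r) (replicate (suc n) 1)
leqB-1∷-ones n b r = subset-shift (D (replicate (suc n) 1)) (D (b ∷ r)) (D-ones-positive (suc n))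

leqB-incHead-ones : ∀ n b r → leqB (incHead (suc b ∷ r)) (replicate (suc (suc n)) 1) ≡ false
leqB-incHead-ones n b r = cong (_∧ subsetB (map (ℕ._+_ 1) (D (1 ∷ replicate n 1))) (D (suc (suc b) ∷ r)))
  (trans (cong (memb 1) (D-incHead (suc b) r)) (trans (memb-suc 0 (D (suc b ∷ r))) (memb-0 _ (D-positive b r))))

filter-below-ones : ∀ i → filterB (λ β → leqB β (replicate i 1)) (comps i) ≡ replicate i 1 ∷ []
filter-below-ones zero = refl
filter-below-ones (suc zero) = refl
filter-below-ones (suc (suc n)) = begin
  filterB p (map (1 ∷_) C ++ map incHead C) ≡⟨ filterB-++ p (map (1 ∷_) C) (map incHead C) ⟩
  filterB p (map (1 ∷_) C) ++ filterB p (map incHead C) ≡⟨ cong₂ _++_ (filterB-map p (1 ∷_) C) (filterB-map p incHead C) ⟩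
  map (1 ∷_) (filterB (λ β → p (1 ∷ β)) C) ++ map incHead (filterB (λ β → p (incHead β)) C)
    ≡⟨ cong₂ (λ u v → map (1 ∷_) u ++ map incHead v) (trans (filterB-cong (All.map (λ {β} → keep-1∷ β) (comps-sound (suc n)))) (filter-below-ones (suc n)))
         (filterB-none (All.map (λ {β} → drop-incHead β) (comps-sound (suc n)))) ⟩
  replicate (suc (suc n)) 1 ∷ [] ∎
  where
  open ≡-Reasoning
  C = comps (suc n)
  p : List ℕ → Bool
  p β = leqB β (replicate (suc (suc n)) 1)
  keep-1∷ : ∀ β → isCompositionOf (suc n) β ≡ true → p (1 ∷ β) ≡ leqB β (replicate (suc n) 1)
  keep-1∷ (suc b ∷ r) e = leqB-1∷-ones n (suc b) r
  drop-incHead : ∀ β → isCompositionOf (suc n) β ≡ true → p (incHead β) ≡ false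
  drop-incHead (suc b ∷ r) e = leqB-incHead-ones n b r

weight-ones : ∀ i → weight (replicate i 1) ≡ i
weight-ones zero = refl
weight-ones (suc i) = cong suc (weight-ones i)

F-ones : ∀ i → F (replicate i 1) ≡ (1ℚ , replicate i 1) ∷ []
F-ones i = trans (cong (λ n → map (λ β → (1ℚ , β)) (filterB (λ β → leqB β (replicate i 1)) (comps n))) (weight-ones i))
             (cong (map (λ β → (1ℚ , β))) (filter-below-ones i))

-- F_{1^i}^⊥ on the H-basis

prependPart : ℕ → List (List ℕ) → List (List ℕ)
prependPart zero L = L
prependPart (suc a) L = map (suc a ∷_) L

-- The words obtained from α by lowering i distinct parts by one and deleting the parts that
-- become 0; a word with a zero part has none.
lowerings : ℕ → List ℕ → List (List ℕ)
lowerings zero α = if allPositive α then α ∷ [] else []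
lowerings (suc i) [] = []
lowerings (suc i) (zero ∷ α) = []
lowerings (suc i) (suc a ∷ α) = map (suc a ∷_) (lowerings (suc i) α) ++ prependPart a (lowerings i α)

sameℕ-sym : ∀ a b → sameℕ a b ≡ sameℕ b a
sameℕ-sym a b with a ℕ.≟ b | b ℕ.≟ a
... | yes _ | yes _ = refl
... | no _  | no _  = refl
... | yes p | no q  = ⊥-elim (q (sym p))
... | no p  | yes q = ⊥-elim (p (sym q))

sameℕ-≢ : ∀ {a b} → ¬ a ≡ b → sameℕ a b ≡ false
sameℕ-≢ {a} {b} neq with a ℕ.≟ b
... | yes p = ⊥-elim (neq p)
... | no _ = refl

count-[]-if : ∀ (b : Bool) x α → count [] (if b then (x ∷ α) ∷ [] else []) ≡ 0ℚ
count-[]-if true x α = QP.+-identityˡ 0ℚ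
count-[]-if false x α = refl

count-[]-lowerings : ∀ i α → count [] (lowerings i α) ≡ 𝟙 (sameWord (replicate i 1) α)
count-[]-lowerings zero [] = QP.+-identityʳ 1ℚ
count-[]-lowerings zero (x ∷ α) = count-[]-if (allPositive (x ∷ α)) x α
count-[]-lowerings (suc i) [] = refl
count-[]-lowerings (suc i) (zero ∷ α) = sym (cong 𝟙 (sameWord-∷-≢ 1 0 (replicate i 1) α (λ ())))
count-[]-lowerings (suc i) (suc zero ∷ α) = trans (count-++ [] (map (1 ∷_) (lowerings (suc i) α)) (lowerings i α))
  (trans (cong (_+q count [] (lowerings i α)) (count-[]-∷ 1 (lowerings (suc i) α)))
  (trans (QP.+-identityˡ (count [] (lowerings i α))) (trans (count-[]-lowerings i α) (sym (cong 𝟙 (sameWord-∷ 1 (replicate i 1) α))))))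
count-[]-lowerings (suc i) (suc (suc a) ∷ α) = trans (count-++ [] (map (suc (suc a) ∷_) (lowerings (suc i) α)) (map (suc a ∷_) (lowerings i α)))
  (trans (cong₂ _+q_ (count-[]-∷ (suc (suc a)) (lowerings (suc i) α)) (count-[]-∷ (suc a) (lowerings i α)))
  (trans (QP.+-identityˡ 0ℚ) (sym (cong 𝟙 (sameWord-∷-≢ 1 (suc (suc a)) (replicate i 1) α (λ ()))))))

count-qsh-1∷ : ∀ b α u y γ → count (b ∷ α) (qsh (1 ∷ u) (suc y ∷ γ))
  ≡ 𝟙 (sameℕ 1 b) *q count α (qsh u (suc y ∷ γ)) +q (𝟙 (sameℕ (suc y) b) *q count α (qsh (1 ∷ u) γ) +q 𝟙 (sameℕ (suc (suc y)) b) *q count α (qsh u γ))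
count-qsh-1∷ b α u y γ = begin
  count (b ∷ α) (map (1 ∷_) Q₁ ++ (map (suc y ∷_) Q₂ ++ map (suc (suc y) ∷_) Q₃))
    ≡⟨ trans (count-++ (b ∷ α) (map (1 ∷_) Q₁) _) (cong (count (b ∷ α) (map (1 ∷_) Q₁) +q_) (count-++ (b ∷ α) (map (suc y ∷_) Q₂) _)) ⟩
  count (b ∷ α) (map (1 ∷_) Q₁) +q (count (b ∷ α) (map (suc y ∷_) Q₂) +q count (b ∷ α) (map (suc (suc y) ∷_) Q₃))
    ≡⟨ cong₂ _+q_ (count-∷ 1 b α Q₁) (cong₂ _+q_ (count-∷ (suc y) b α Q₂) (count-∷ (suc (suc y)) b α Q₃)) ⟩
  𝟙 (sameℕ 1 b) *q count α Q₁ +q (𝟙 (sameℕ (suc y) b) *q count α Q₂ +q 𝟙 (sameℕ (suc (suc y)) b) *q count α Q₃) ∎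
  where
  open ≡-Reasoning
  Q₁ = qsh u (suc y ∷ γ)
  Q₂ = qsh (1 ∷ u) γ
  Q₃ = qsh u γ

count-prependPart-split : ∀ a y X γ L →
  𝟙 (sameℕ 1 (suc a)) *q count (suc y ∷ γ) L +q (𝟙 (sameℕ (suc y) (suc a)) *q X +q 𝟙 (sameℕ (suc (suc y)) (suc a)) *q count γ L)
    ≡ 𝟙 (sameℕ (suc a) (suc y)) *q X +q count (suc y ∷ γ) (prependPart a L)
count-prependPart-split zero y X γ L = begin
  1ℚ *q X₁ +q (𝟙 (sameℕ (suc y) 1) *q X +q 𝟙 (sameℕ (suc (suc y)) 1) *q X₃)
    ≡⟨ cong₂ _+q_ (QP.*-identityˡ X₁) (cong₂ _+q_ (cong (λ b → 𝟙 b *q X) (sameℕ-sym (suc y) 1))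
         (trans (cong (λ b → 𝟙 b *q X₃) (sameℕ-≢ {suc (suc y)} {1} (λ e → ℕP.0≢1+n (sym (ℕP.suc-injective e))))) (QP.*-zeroˡ X₃))) ⟩
  X₁ +q (𝟙 (sameℕ 1 (suc y)) *q X +q 0ℚ)   ≡⟨ cong (X₁ +q_) (QP.+-identityʳ _) ⟩
  X₁ +q 𝟙 (sameℕ 1 (suc y)) *q X           ≡⟨ QP.+-comm X₁ _ ⟩
  𝟙 (sameℕ 1 (suc y)) *q X +q X₁           ∎
  where
  open ≡-Reasoning
  X₁ = count (suc y ∷ γ) L
  X₃ = count γ L
count-prependPart-split (suc a) y X γ L = begin
  𝟙 (sameℕ 1 (suc (suc a))) *q X₁ +q (𝟙 (sameℕ (suc y) (suc (suc a))) *q X +q 𝟙 (sameℕ (suc (suc y)) (suc (suc a))) *q X₃)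
    ≡⟨ cong₂ _+q_ (trans (cong (λ b → 𝟙 b *q X₁) (sameℕ-≢ {1} {suc (suc a)} (λ e → ℕP.0≢1+n (ℕP.suc-injective e)))) (QP.*-zeroˡ X₁))
        (cong₂ _+q_ (cong (λ b → 𝟙 b *q X) (sameℕ-sym (suc y) (suc (suc a))))
                    (cong (λ b → 𝟙 b *q X₃) (trans (⌊≟⌋-suc (suc y) (suc a)) (sameℕ-sym (suc y) (suc a))))) ⟩
  0ℚ +q (𝟙 (sameℕ (suc (suc a)) (suc y)) *q X +q 𝟙 (sameℕ (suc a) (suc y)) *q X₃)  ≡⟨ QP.+-identityˡ _ ⟩
  𝟙 (sameℕ (suc (suc a)) (suc y)) *q X +q 𝟙 (sameℕ (suc a) (suc y)) *q X₃
    ≡⟨ cong (𝟙 (sameℕ (suc (suc a)) (suc y)) *q X +q_) (sym (count-∷ (suc a) (suc y) γ L)) ⟩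
  𝟙 (sameℕ (suc (suc a)) (suc y)) *q X +q count (suc y ∷ γ) (map (suc a ∷_) L) ∎
  where
  open ≡-Reasoning
  X₁ = count (suc y ∷ γ) L
  X₃ = count γ L

count-qsh-ones : ∀ i α γ → allPositive γ ≡ true → count α (qsh (replicate i 1) γ) ≡ count γ (lowerings i α)
count-qsh-ones zero α γ pγ with allPositive α in eq
... | true = trans (QP.+-identityʳ (𝟙 (sameWord γ α))) (trans (cong 𝟙 (sameWord-sym γ α)) (sym (QP.+-identityʳ (𝟙 (sameWord α γ)))))
... | false = trans (QP.+-identityʳ (𝟙 (sameWord γ α))) (cong 𝟙 (sameWord-≢ {γ} {α} (λ γ≡α → true≢false (trans (sym pγ) (trans (cong allPositive γ≡α) eq)))))
count-qsh-ones (suc i) α [] pγ = trans (QP.+-identityʳ (𝟙 (sameWord (1 ∷ replicate i 1) α))) (sym (count-[]-lowerings (suc i) α))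
count-qsh-ones (suc i) [] (suc y ∷ γ) pγ =
  trans (count-++ [] (map (1 ∷_) Q₁) (map (suc y ∷_) Q₂ ++ map (suc (suc y) ∷_) Q₃))
    (trans (cong₂ _+q_ (count-[]-∷ 1 Q₁) (trans (count-++ [] (map (suc y ∷_) Q₂) (map (suc (suc y) ∷_) Q₃))
                                           (trans (cong₂ _+q_ (count-[]-∷ (suc y) Q₂) (count-[]-∷ (suc (suc y)) Q₃)) (QP.+-identityˡ 0ℚ))))
           (QP.+-identityˡ 0ℚ))
  where
  Q₁ = qsh (replicate i 1) (suc y ∷ γ)
  Q₂ = qsh (1 ∷ replicate i 1) γ
  Q₃ = qsh (replicate i 1) γ
count-qsh-ones (suc i) (zero ∷ α) (suc y ∷ γ) pγ =
  trans (count-qsh-1∷ 0 α (replicate i 1) y γ)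
    (trans (cong₂ _+q_ (QP.*-zeroˡ (count α (qsh (replicate i 1) (suc y ∷ γ))))
                       (cong₂ _+q_ (QP.*-zeroˡ (count α (qsh (1 ∷ replicate i 1) γ))) (QP.*-zeroˡ (count α (qsh (replicate i 1) γ)))))
           (trans (QP.+-identityˡ _) (QP.+-identityˡ 0ℚ)))
count-qsh-ones (suc i) (suc a ∷ α) (suc y ∷ γ) pγ = begin
  count (suc a ∷ α) (qsh (1 ∷ replicate i 1) (suc y ∷ γ))
    ≡⟨ count-qsh-1∷ (suc a) α (replicate i 1) y γ ⟩
  𝟙 (sameℕ 1 (suc a)) *q count α (qsh (replicate i 1) (suc y ∷ γ))
    +q (𝟙 (sameℕ (suc y) (suc a)) *q count α (qsh (1 ∷ replicate i 1) γ) +q 𝟙 (sameℕ (suc (suc y)) (suc a)) *q count α (qsh (replicate i 1) γ))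
    ≡⟨ cong₂ (λ u v → 𝟙 (sameℕ 1 (suc a)) *q u +q (𝟙 (sameℕ (suc y) (suc a)) *q count α (qsh (1 ∷ replicate i 1) γ) +q 𝟙 (sameℕ (suc (suc y)) (suc a)) *q v))
             (count-qsh-ones i α (suc y ∷ γ) pγ) (count-qsh-ones i α γ pγ) ⟩
  𝟙 (sameℕ 1 (suc a)) *q count (suc y ∷ γ) (lowerings i α)
    +q (𝟙 (sameℕ (suc y) (suc a)) *q count α (qsh (1 ∷ replicate i 1) γ) +q 𝟙 (sameℕ (suc (suc y)) (suc a)) *q count γ (lowerings i α))
    ≡⟨ count-prependPart-split a y _ γ (lowerings i α) ⟩
  𝟙 (sameℕ (suc a) (suc y)) *q count α (qsh (1 ∷ replicate i 1) γ) +q count (suc y ∷ γ) (prependPart a (lowerings i α))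
    ≡⟨ cong (λ u → 𝟙 (sameℕ (suc a) (suc y)) *q u +q count (suc y ∷ γ) (prependPart a (lowerings i α))) (count-qsh-ones (suc i) α γ pγ) ⟩
  𝟙 (sameℕ (suc a) (suc y)) *q count γ (lowerings (suc i) α) +q count (suc y ∷ γ) (prependPart a (lowerings i α))
    ≡⟨ cong (_+q count (suc y ∷ γ) (prependPart a (lowerings i α))) (sym (count-∷ (suc a) (suc y) γ (lowerings (suc i) α))) ⟩
  count (suc y ∷ γ) (map (suc a ∷_) (lowerings (suc i) α)) +q count (suc y ∷ γ) (prependPart a (lowerings i α))
    ≡⟨ sym (count-++ (suc y ∷ γ) (map (suc a ∷_) (lowerings (suc i) α)) (prependPart a (lowerings i α))) ⟩
  count (suc y ∷ γ) (lowerings (suc i) (suc a ∷ α)) ∎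
  where open ≡-Reasoning

isCompositionOf-∷ : ∀ a m v → isCompositionOf (suc a + m) (suc a ∷ v) ≡ isCompositionOf m v
isCompositionOf-∷ zero m v = refl
isCompositionOf-∷ (suc a) m v = isCompositionOf-∷ a m v

allPositive⇒isCompositionOf : ∀ α → allPositive α ≡ true → isCompositionOf (weight α) α ≡ true
allPositive⇒isCompositionOf [] p = refl
allPositive⇒isCompositionOf (suc a ∷ α) p = trans (isCompositionOf-∷ a (weight α) α) (allPositive⇒isCompositionOf α p)

isCompositionOf⇒allPositive : ∀ n γ → isCompositionOf n γ ≡ true → allPositive γ ≡ true
isCompositionOf⇒allPositive zero [] e = refl
isCompositionOf⇒allPositive (suc n) (suc zero ∷ v) e = isCompositionOf⇒allPositive n v e
isCompositionOf⇒allPositive (suc n) (suc (suc b) ∷ v) e = isCompositionOf⇒allPositive n (suc b ∷ v) e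
isCompositionOf⇒allPositive zero (zero ∷ v) ()
isCompositionOf⇒allPositive zero (suc b ∷ v) ()
isCompositionOf⇒allPositive (suc n) [] ()
isCompositionOf⇒allPositive (suc n) (zero ∷ v) ()

isCompositionOf⇒weight : ∀ n γ → isCompositionOf n γ ≡ true → weight γ ≡ n
isCompositionOf⇒weight zero [] e = refl
isCompositionOf⇒weight (suc n) (suc zero ∷ v) e = cong suc (isCompositionOf⇒weight n v e)
isCompositionOf⇒weight (suc n) (suc (suc b) ∷ v) e = cong suc (isCompositionOf⇒weight n (suc b ∷ v) e)
isCompositionOf⇒weight zero (zero ∷ v) ()
isCompositionOf⇒weight zero (suc b ∷ v) ()
isCompositionOf⇒weight (suc n) [] ()
isCompositionOf⇒weight (suc n) (zero ∷ v) ()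

LoweringOf : ℕ → List ℕ → List ℕ → Set
LoweringOf i α w = (allPositive w ≡ true) × (weight w + i ≡ weight α)

lowerings-sound : ∀ i α → All (LoweringOf i α) (lowerings i α)
lowerings-sound zero α with allPositive α in eq
... | true = (eq , ℕP.+-identityʳ (weight α)) ∷ []
... | false = []
lowerings-sound (suc i) [] = []
lowerings-sound (suc i) (zero ∷ α) = []
lowerings-sound (suc i) (suc a ∷ α) = AllP.++⁺ (AllP.map⁺ (All.map (λ {w} → sound-∷ {w}) (lowerings-sound (suc i) α))) (sound-prependPart a (lowerings-sound i α))
  where
  sound-∷ : ∀ {w} → LoweringOf (suc i) α w → LoweringOf (suc i) (suc a ∷ α) (suc a ∷ w)
  sound-∷ {w} (p , e) = p , trans (ℕP.+-assoc (suc a) (weight w) (suc i)) (cong (λ z → suc a + z) e)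
  sound-prependPart : ∀ a → All (LoweringOf i α) (lowerings i α) → All (LoweringOf (suc i) (suc a ∷ α)) (prependPart a (lowerings i α))
  sound-prependPart zero al = All.map (λ {w} → λ { (p , e) → p , trans (ℕP.+-suc (weight w) i) (cong suc e) }) al
  sound-prependPart (suc a) al = AllP.map⁺ (All.map (λ {w} → λ { (p , e) → p , trans (ℕP.+-assoc (suc a) (weight w) (suc i))
     (trans (cong (λ z → suc a + z) (ℕP.+-suc (weight w) i)) (trans (cong (λ z → suc a + suc z) e) (ℕP.+-suc (suc a) (weight α)))) }) al)

𝟙-subst : ∀ w γ (h : List ℕ → ℚ) → 𝟙 (sameWord w γ) *q h w ≡ 𝟙 (sameWord w γ) *q h γ
𝟙-subst w γ h = by-dec (LP.≡-dec ℕ._≟_ w γ)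
  where
  by-dec : Dec (w ≡ γ) → 𝟙 (sameWord w γ) *q h w ≡ 𝟙 (sameWord w γ) *q h γ
  by-dec (yes refl) = refl
  by-dec (no neq) = trans (cong (λ b → 𝟙 b *q h w) (sameWord-≢ neq)) (trans (QP.*-zeroˡ (h w)) (sym (trans (cong (λ b → 𝟙 b *q h γ) (sameWord-≢ neq)) (QP.*-zeroˡ (h γ)))))

coeff-graph : ∀ (h : List ℕ → ℚ) L γ → coeff (map (λ γ' → (h γ' , γ')) L) γ ≡ count γ L *q h γ
coeff-graph h [] γ = sym (QP.*-zeroˡ (h γ))
coeff-graph h (w ∷ L) γ = trans (coeff-cons (h w) w (map (λ γ' → (h γ' , γ')) L) γ)
  (trans (cong₂ _+q_ (𝟙-subst w γ h) (coeff-graph h L γ)) (sym (QP.*-distribʳ-+ (h γ) (𝟙 (sameWord w γ)) (count γ L))))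

pairH-qsh : ∀ α u γ → pairH α (((1ℚ , u) ∷ []) ⋆ M γ) ≡ count α (qsh u γ)
pairH-qsh α u γ = trans (cong (λ z → coeff z α) (trans (LP.++-identityʳ (fromWords (qsh u γ) ++ [])) (LP.++-identityʳ (fromWords (qsh u γ)))))
  (coeff-fromWords (qsh u γ) α)

coeff-perp-ones : ∀ i α γ → coeff (perpBasis i (F (replicate i 1)) α) γ ≡ count γ (lowerings i α)
coeff-perp-ones i α γ rewrite F-ones i = begin
  coeff (map (λ γ' → (pairH α (((1ℚ , replicate i 1) ∷ []) ⋆ M γ') , γ')) (comps n)) γ
    ≡⟨ coeff-graph (λ γ' → pairH α (((1ℚ , replicate i 1) ∷ []) ⋆ M γ')) (comps n) γ ⟩
  count γ (comps n) *q pairH α (((1ℚ , replicate i 1) ∷ []) ⋆ M γ)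
    ≡⟨ cong₂ _*q_ (count-comps n γ) (pairH-qsh α (replicate i 1) γ) ⟩
  𝟙 (isCompositionOf n γ) *q count α (qsh (replicate i 1) γ) ≡⟨ by-isComposition (isCompositionOf n γ) refl ⟩
  count γ (lowerings i α) ∎
  where
  open ≡-Reasoning
  n = weight α ∸ i
  by-isComposition : ∀ b → isCompositionOf n γ ≡ b → 𝟙 b *q count α (qsh (replicate i 1) γ) ≡ count γ (lowerings i α)
  by-isComposition true e = trans (QP.*-identityˡ (count α (qsh (replicate i 1) γ))) (count-qsh-ones i α γ (isCompositionOf⇒allPositive n γ e))
  by-isComposition false e = trans (QP.*-zeroˡ (count α (qsh (replicate i 1) γ))) (sym (count-absent γ (lowerings i α) (All.map (λ {w} → lowering≢ {w}) (lowerings-sound i α))))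
    where
    lowering≢ : ∀ {w} → LoweringOf i α w → ¬ w ≡ γ
    lowering≢ {w} (p , ew) refl = true≢false (trans (sym w-composition) e)
      where
      w-composition : isCompositionOf n w ≡ true
      w-composition = subst (λ m → isCompositionOf m w ≡ true) (trans (sym (ℕP.m+n∸n≡m (weight w) i)) (cong (_∸ i) ew))
                            (allPositive⇒isCompositionOf w p)

perpBasis-ones : ∀ i α → perpBasis i (F (replicate i 1)) α ≋ fromWords (lowerings i α)
perpBasis-ones i α = mk≋ λ γ → trans (coeff-perp-ones i α γ) (sym (coeff-fromWords (lowerings i α) γ))

perp-ones : ∀ i α → perp i (F (replicate i 1)) ((1ℚ , α) ∷ []) ≋ fromWords (lowerings i α)
perp-ones i α = ≋-trans (++-identityʳ-≋ _) (≋-trans (scale-1 _) (perpBasis-ones i α))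

-- The product of NSym

singleton-cong : ∀ {c c'} w → c ≡ c' → (c , w) ∷ [] ≋ (c' , w) ∷ []
singleton-cong w refl = ≋-refl

mapWords : (List ℕ → List ℕ) → Lin → Lin
mapWords f = map (λ { (d , w) → (d , f w) })

mapWords-extend : ∀ f x → mapWords f x ≋ extend (λ w → (1ℚ , f w) ∷ []) x
mapWords-extend f [] = ≋-refl
mapWords-extend f ((d , w) ∷ x) = ++-cong {(d , f w) ∷ []} (singleton-cong (f w) (sym (QP.*-identityʳ d))) (mapWords-extend f x)

mapWords-cong : ∀ f {x y} → x ≋ y → mapWords f x ≋ mapWords f y
mapWords-cong f {x} {y} p = ≋-trans (mapWords-extend f x) (≋-trans (extend-cong _ p) (≋-sym (mapWords-extend f y)))

mapWords-++ : ∀ f x y → mapWords f (x ++ y) ≡ mapWords f x ++ mapWords f y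
mapWords-++ f x y = LP.map-++ _ x y

mapWords-scale : ∀ f c x → mapWords f (scale c x) ≡ scale c (mapWords f x)
mapWords-scale f c [] = refl
mapWords-scale f c ((d , w) ∷ x) = cong (_ ∷_) (mapWords-scale f c x)

extend-pointwise-++ : ∀ f g x → extend (λ α → f α ++ g α) x ≋ extend f x ++ extend g x
extend-pointwise-++ f g [] = ≋-refl
extend-pointwise-++ f g ((c , α) ∷ x) = begin
  scale c (f α ++ g α) ++ extend (λ α → f α ++ g α) x ≈⟨ ++-cong (≡⇒≋ (scale-++ c (f α) (g α))) (extend-pointwise-++ f g x) ⟩
  (scale c (f α) ++ scale c (g α)) ++ (extend f x ++ extend g x) ≈⟨ ++-interchange (scale c (f α)) _ _ _ ⟩
  (scale c (f α) ++ extend f x) ++ (scale c (g α) ++ extend g x) ∎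
  where open ≋R

extend-pointwise-scale : ∀ c f x → extend (λ α → scale c (f α)) x ≋ scale c (extend f x)
extend-pointwise-scale c f [] = ≋-refl
extend-pointwise-scale c f ((d , α) ∷ x) = begin
  scale d (scale c (f α)) ++ extend (λ α → scale c (f α)) x
    ≈⟨ ++-cong (≋-trans (scale-scale d c (f α)) (≡⇒≋ (cong (λ z → scale z (f α)) (QP.*-comm d c)))) (extend-pointwise-scale c f x) ⟩
  scale (c *q d) (f α) ++ scale c (extend f x) ≈⟨ ++-congˡ _ (≋-sym (scale-scale c d (f α))) ⟩
  scale c (scale d (f α)) ++ scale c (extend f x) ≈⟨ ≡⇒≋ (sym (scale-++ c (scale d (f α)) (extend f x))) ⟩
  scale c (scale d (f α) ++ extend f x) ∎
  where open ≋R

prependWord : List ℕ → Lin → Lin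
prependWord u = mapWords (u ++_)

·-extend : ∀ x y → x · y ≡ extend (λ u → prependWord u y) x
·-extend [] y = refl
·-extend ((c , u) ∷ x) y = cong₂ _++_ (row y) (·-extend x y)
  where
  row : ∀ y → map (λ { (d , v) → (c *q d , u ++ v) }) y ≡ scale c (prependWord u y)
  row [] = refl
  row ((d , v) ∷ y) = cong (_ ∷_) (row y)

concatWords : List ℕ → List ℕ → Lin
concatWords u v = (1ℚ , u ++ v) ∷ []

·-extend₂ : ∀ x y → x · y ≋ extend (λ u → extend (λ v → concatWords u v) y) x
·-extend₂ x y = ≋-trans (≡⇒≋ (·-extend x y)) (extend-pointwise x (λ u → mapWords-extend (u ++_) y))

·-cong : ∀ {x x' y y'} → x ≋ x' → y ≋ y' → x · y ≋ x' · y'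
·-cong {x} {x'} {y} {y'} p q = begin
  x · y ≈⟨ ·-extend₂ x y ⟩
  extend (λ u → extend (λ v → concatWords u v) y) x ≈⟨ extend-cong _ p ⟩
  extend (λ u → extend (λ v → concatWords u v) y) x' ≈⟨ extend-pointwise x' (λ u → extend-cong _ q) ⟩
  extend (λ u → extend (λ v → concatWords u v) y') x' ≈⟨ ≋-sym (·-extend₂ x' y') ⟩
  x' · y' ∎
  where open ≋R

·-++ˡ : ∀ x x' y → (x ++ x') · y ≡ x · y ++ x' · y
·-++ˡ x x' y = trans (·-extend (x ++ x') y) (trans (extend-++ _ x x') (sym (cong₂ _++_ (·-extend x y) (·-extend x' y))))

·-scaleˡ : ∀ c x y → scale c x · y ≋ scale c (x · y)
·-scaleˡ c x y = ≋-trans (≡⇒≋ (·-extend (scale c x) y)) (≋-trans (extend-scale _ c x) (scale-cong c (≡⇒≋ (sym (·-extend x y)))))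

·-[]ʳ : ∀ x → x · [] ≡ []
·-[]ʳ [] = refl
·-[]ʳ ((c , u) ∷ x) = ·-[]ʳ x

·-++ʳ : ∀ x y y' → x · (y ++ y') ≋ x · y ++ x · y'
·-++ʳ x y y' = ≋-trans (≡⇒≋ (·-extend x (y ++ y'))) (≋-trans (extend-pointwise x (λ u → ≡⇒≋ (mapWords-++ (u ++_) y y')))
  (≋-trans (extend-pointwise-++ _ _ x) (≡⇒≋ (sym (cong₂ _++_ (·-extend x y) (·-extend x y'))))))

·-scaleʳ : ∀ c x y → x · scale c y ≋ scale c (x · y)
·-scaleʳ c x y = ≋-trans (≡⇒≋ (·-extend x (scale c y))) (≋-trans (extend-pointwise x (λ u → ≡⇒≋ (mapWords-scale (u ++_) c y)))
  (≋-trans (extend-pointwise-scale c _ x) (scale-cong c (≡⇒≋ (sym (·-extend x y))))))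

·-identityˡ : ∀ y → oneN · y ≋ y
·-identityˡ y = ≡⇒≋ (trans (LP.++-identityʳ _) (unit-row y))
  where
  unit-row : ∀ y → map (λ { (d , v) → (1ℚ *q d , [] ++ v) }) y ≡ y
  unit-row [] = refl
  unit-row ((d , v) ∷ y) = cong₂ _∷_ (cong (_, v) (QP.*-identityˡ d)) (unit-row y)

·-identityʳ : ∀ x → x · oneN ≋ x
·-identityʳ x = ≋-trans (≡⇒≋ (·-extend x oneN)) (≋-trans (extend-pointwise x (λ u → singleton-cong (u ++ []) refl))
  (≋-trans (extend-pointwise x (λ u → ≡⇒≋ (cong (λ w → (1ℚ , w) ∷ []) (LP.++-identityʳ u)))) (extend-singleton x)))
  where
  extend-singleton : ∀ x → extend (λ u → (1ℚ , u) ∷ []) x ≋ x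
  extend-singleton [] = ≋-refl
  extend-singleton ((c , u) ∷ x) = ++-cong {(c *q 1ℚ , u) ∷ []} (singleton-cong u (QP.*-identityʳ c)) (extend-singleton x)

prepend : ℕ → Lin → Lin
prepend s = mapWords (s ∷_)

prepend-· : ∀ s x y → prepend s x · y ≡ prepend s (x · y)
prepend-· s [] y = refl
prepend-· s ((c , u) ∷ x) y = trans (cong₂ _++_ (sym (row y)) (prepend-· s x y)) (sym (mapWords-++ (s ∷_) _ (x · y)))
  where
  row : ∀ y → mapWords (s ∷_) (map (λ { (d , v) → (c *q d , u ++ v) }) y) ≡ map (λ { (d , v) → (c *q d , (s ∷ u) ++ v) }) y
  row [] = refl
  row ((d , v) ∷ y) = cong (_ ∷_) (row y)

-- The Leibniz rule for F_{1^i}^⊥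

loweringsLin : ℕ → List ℕ → Lin
loweringsLin i α = fromWords (lowerings i α)

-- F_{1^i}^⊥, by perp-ones.
∂ : ℕ → Lin → Lin
∂ i x = extend (loweringsLin i) x

convolve : (ℕ → Lin) → (ℕ → Lin) → ℕ → Lin
convolve f g zero = f 0 · g 0
convolve f g (suc i) = f 0 · g (suc i) ++ convolve (λ a → f (suc a)) g i

convolve-cong : ∀ {f f' g g'} → (∀ a → f a ≋ f' a) → (∀ b → g b ≋ g' b) → ∀ i → convolve f g i ≋ convolve f' g' i
convolve-cong p q zero = ·-cong (p 0) (q 0)
convolve-cong p q (suc i) = ++-cong (·-cong (p 0) (q (suc i))) (convolve-cong (λ a → p (suc a)) q i)

convolve-++ˡ : ∀ f f' g i → convolve (λ a → f a ++ f' a) g i ≋ convolve f g i ++ convolve f' g i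
convolve-++ˡ f f' g zero = ≡⇒≋ (·-++ˡ (f 0) (f' 0) (g 0))
convolve-++ˡ f f' g (suc i) = begin
  (f 0 ++ f' 0) · g (suc i) ++ convolve (λ a → f (suc a) ++ f' (suc a)) g i
    ≈⟨ ++-cong (≡⇒≋ (·-++ˡ (f 0) (f' 0) (g (suc i)))) (convolve-++ˡ (λ a → f (suc a)) (λ a → f' (suc a)) g i) ⟩
  (f 0 · g (suc i) ++ f' 0 · g (suc i)) ++ (convolve (λ a → f (suc a)) g i ++ convolve (λ a → f' (suc a)) g i)
    ≈⟨ ++-interchange (f 0 · g (suc i)) _ _ _ ⟩
  convolve f g (suc i) ++ convolve f' g (suc i) ∎
  where open ≋R

convolve-++ʳ : ∀ f g g' i → convolve f (λ b → g b ++ g' b) i ≋ convolve f g i ++ convolve f g' i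
convolve-++ʳ f g g' zero = ·-++ʳ (f 0) (g 0) (g' 0)
convolve-++ʳ f g g' (suc i) = begin
  f 0 · (g (suc i) ++ g' (suc i)) ++ convolve (λ a → f (suc a)) (λ b → g b ++ g' b) i
    ≈⟨ ++-cong (·-++ʳ (f 0) (g (suc i)) (g' (suc i))) (convolve-++ʳ (λ a → f (suc a)) g g' i) ⟩
  (f 0 · g (suc i) ++ f 0 · g' (suc i)) ++ (convolve (λ a → f (suc a)) g i ++ convolve (λ a → f (suc a)) g' i)
    ≈⟨ ++-interchange (f 0 · g (suc i)) _ _ _ ⟩
  convolve f g (suc i) ++ convolve f g' (suc i) ∎
  where open ≋R

convolve-scaleˡ : ∀ c f g i → convolve (λ a → scale c (f a)) g i ≋ scale c (convolve f g i)
convolve-scaleˡ c f g zero = ·-scaleˡ c (f 0) (g 0)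
convolve-scaleˡ c f g (suc i) = ≋-trans (++-cong (·-scaleˡ c (f 0) (g (suc i))) (convolve-scaleˡ c (λ a → f (suc a)) g i))
  (≡⇒≋ (sym (scale-++ c (f 0 · g (suc i)) _)))

convolve-scaleʳ : ∀ c f g i → convolve f (λ b → scale c (g b)) i ≋ scale c (convolve f g i)
convolve-scaleʳ c f g zero = ·-scaleʳ c (f 0) (g 0)
convolve-scaleʳ c f g (suc i) = ≋-trans (++-cong (·-scaleʳ c (f 0) (g (suc i))) (convolve-scaleʳ c (λ a → f (suc a)) g i))
  (≡⇒≋ (sym (scale-++ c (f 0 · g (suc i)) _)))

convolve-zeroˡ : ∀ f g i → (∀ a → f a ≡ []) → convolve f g i ≋ []
convolve-zeroˡ f g zero p rewrite p 0 = ≋-refl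
convolve-zeroˡ f g (suc i) p rewrite p 0 = convolve-zeroˡ (λ a → f (suc a)) g i (λ a → p (suc a))

convolve-zeroʳ : ∀ f g i → (∀ b → g b ≡ []) → convolve f g i ≋ []
convolve-zeroʳ f g zero p rewrite p 0 = ≡⇒≋ (·-[]ʳ (f 0))
convolve-zeroʳ f g (suc i) p rewrite p (suc i) = ≋-trans (++-congˡ _ (≡⇒≋ (·-[]ʳ (f 0)))) (convolve-zeroʳ (λ a → f (suc a)) g i p)

convolve-extendˡ : ∀ (F : ℕ → List ℕ → Lin) x g i → convolve (λ a → extend (F a) x) g i ≋ extend (λ u → convolve (λ a → F a u) g i) x
convolve-extendˡ F [] g i = convolve-zeroˡ (λ a → []) g i (λ a → refl)
convolve-extendˡ F ((c , u) ∷ x) g i = begin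
  convolve (λ a → scale c (F a u) ++ extend (F a) x) g i ≈⟨ convolve-++ˡ _ _ g i ⟩
  convolve (λ a → scale c (F a u)) g i ++ convolve (λ a → extend (F a) x) g i
    ≈⟨ ++-cong (convolve-scaleˡ c (λ a → F a u) g i) (convolve-extendˡ F x g i) ⟩
  scale c (convolve (λ a → F a u) g i) ++ extend (λ u → convolve (λ a → F a u) g i) x ∎
  where open ≋R

convolve-extendʳ : ∀ (G : ℕ → List ℕ → Lin) f y i → convolve f (λ b → extend (G b) y) i ≋ extend (λ v → convolve f (λ b → G b v) i) y
convolve-extendʳ G f [] i = convolve-zeroʳ f (λ b → []) i (λ b → refl)
convolve-extendʳ G f ((c , v) ∷ y) i = begin
  convolve f (λ b → scale c (G b v) ++ extend (G b) y) i ≈⟨ convolve-++ʳ f _ _ i ⟩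
  convolve f (λ b → scale c (G b v)) i ++ convolve f (λ b → extend (G b) y) i
    ≈⟨ ++-cong (convolve-scaleʳ c f (λ b → G b v) i) (convolve-extendʳ G f y i) ⟩
  scale c (convolve f (λ b → G b v) i) ++ extend (λ v → convolve f (λ b → G b v) i) y ∎
  where open ≋R

convolve-prepend : ∀ s f g i → convolve (λ a → prepend s (f a)) g i ≋ prepend s (convolve f g i)
convolve-prepend s f g zero = ≡⇒≋ (prepend-· s (f 0) (g 0))
convolve-prepend s f g (suc i) = ≋-trans (++-cong (≡⇒≋ (prepend-· s (f 0) (g (suc i)))) (convolve-prepend s (λ a → f (suc a)) g i))
  (≡⇒≋ (sym (mapWords-++ (s ∷_) (f 0 · g (suc i)) _)))

prependPartLin : ℕ → Lin → Lin
prependPartLin zero X = X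
prependPartLin (suc a) X = prepend (suc a) X

prependPartLin-cong : ∀ c {x y} → x ≋ y → prependPartLin c x ≋ prependPartLin c y
prependPartLin-cong zero p = p
prependPartLin-cong (suc c) p = mapWords-cong _ p

convolve-prependPartLin : ∀ c f g i → convolve (λ a → prependPartLin c (f a)) g i ≋ prependPartLin c (convolve f g i)
convolve-prependPartLin zero f g i = ≋-refl
convolve-prependPartLin (suc c) f g i = convolve-prepend (suc c) f g i

lowerHead : ℕ → List ℕ → ℕ → Lin
lowerHead c w zero = []
lowerHead c w (suc j) = prependPartLin c (loweringsLin j w)

fromWords-map : ∀ s L → fromWords (map (s ∷_) L) ≡ prepend s (fromWords L)
fromWords-map s [] = refl
fromWords-map s (w ∷ L) = cong (_ ∷_) (fromWords-map s L)

fromWords-prependPart : ∀ c L → fromWords (prependPart c L) ≡ prependPartLin c (fromWords L)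
fromWords-prependPart zero L = refl
fromWords-prependPart (suc c) L = fromWords-map (suc c) L

loweringsLin-∷ : ∀ c w a → loweringsLin a (suc c ∷ w) ≡ prepend (suc c) (loweringsLin a w) ++ lowerHead c w a
loweringsLin-∷ c w zero with allPositive w
... | true = refl
... | false = refl
loweringsLin-∷ c w (suc j) = trans (LP.map-++ _ (map (suc c ∷_) (lowerings (suc j) w)) (prependPart c (lowerings j w)))
  (cong₂ _++_ (fromWords-map (suc c) (lowerings (suc j) w)) (fromWords-prependPart c (lowerings j w)))

loweringsLin-++ : ∀ u v i → loweringsLin i (u ++ v) ≋ convolve (λ a → loweringsLin a u) (λ b → loweringsLin b v) i
loweringsLin-++ [] v zero = ≋-sym (·-identityˡ (loweringsLin 0 v))
loweringsLin-++ [] v (suc i) = ≋-sym (≋-trans (++-cong (·-identityˡ (loweringsLin (suc i) v))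
                                                      (convolve-zeroˡ (λ a → loweringsLin (suc a) []) (λ b → loweringsLin b v) i (λ a → refl)))
                                             (++-identityʳ-≋ _))
loweringsLin-++ (zero ∷ u) v i = ≋-sym (≋-trans (convolve-zeroˡ (λ a → loweringsLin a (zero ∷ u)) (λ b → loweringsLin b v) i (zero-head u)) (≡⇒≋ (sym (zero-head (u ++ v) i))))
  where
  zero-head : ∀ w a → loweringsLin a (zero ∷ w) ≡ []
  zero-head w zero = refl
  zero-head w (suc a) = refl
loweringsLin-++ (suc c ∷ u) v i = begin
  loweringsLin i (suc c ∷ (u ++ v)) ≈⟨ ≡⇒≋ (loweringsLin-∷ c (u ++ v) i) ⟩
  prepend (suc c) (loweringsLin i (u ++ v)) ++ lowerHead c (u ++ v) i
    ≈⟨ ++-cong (mapWords-cong _ (loweringsLin-++ u v i)) (lowerHead-++ i) ⟩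
  prepend (suc c) (convolve lowerU g i) ++ convolve (lowerHead c u) g i ≈⟨ ++-congˡ _ (≋-sym (convolve-prepend (suc c) lowerU g i)) ⟩
  convolve (λ a → prepend (suc c) (lowerU a)) g i ++ convolve (lowerHead c u) g i ≈⟨ ≋-sym (convolve-++ˡ _ _ g i) ⟩
  convolve (λ a → prepend (suc c) (loweringsLin a u) ++ lowerHead c u a) g i
    ≈⟨ convolve-cong (λ a → ≡⇒≋ (sym (loweringsLin-∷ c u a))) (λ b → ≋-refl) i ⟩
  convolve (λ a → loweringsLin a (suc c ∷ u)) g i ∎
  where
  open ≋R
  lowerU = λ a → loweringsLin a u
  g = λ b → loweringsLin b v
  lowerHead-++ : ∀ i → lowerHead c (u ++ v) i ≋ convolve (lowerHead c u) g i
  lowerHead-++ zero = ≋-refl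
  lowerHead-++ (suc j) = ≋-trans (prependPartLin-cong c (loweringsLin-++ u v j)) (≋-sym (convolve-prependPartLin c lowerU g j))

∂-· : ∀ x y i → ∂ i (x · y) ≋ convolve (λ a → ∂ a x) (λ b → ∂ b y) i
∂-· x y i = begin
  ∂ i (x · y) ≈⟨ extend-cong (loweringsLin i) (·-extend₂ x y) ⟩
  extend (loweringsLin i) (extend (λ u → extend (λ v → concatWords u v) y) x) ≈⟨ extend-extend (loweringsLin i) _ x ⟩
  extend (λ u → extend (loweringsLin i) (extend (λ v → concatWords u v) y)) x
    ≈⟨ extend-pointwise x (λ u → extend-extend (loweringsLin i) _ y) ⟩
  extend (λ u → extend (λ v → extend (loweringsLin i) (concatWords u v)) y) x
    ≈⟨ extend-pointwise x (λ u → extend-pointwise y (λ v → extend-single (loweringsLin i) (u ++ v))) ⟩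
  extend (λ u → extend (λ v → loweringsLin i (u ++ v)) y) x ≈⟨ extend-pointwise x (λ u → extend-pointwise y (λ v → loweringsLin-++ u v i)) ⟩
  extend (λ u → extend (λ v → convolve (λ a → loweringsLin a u) (λ b → loweringsLin b v) i) y) x
    ≈⟨ extend-pointwise x (λ u → ≋-sym (convolve-extendʳ loweringsLin (λ a → loweringsLin a u) y i)) ⟩
  extend (λ u → convolve (λ a → loweringsLin a u) (λ b → ∂ b y) i) x ≈⟨ ≋-sym (convolve-extendˡ loweringsLin x (λ b → ∂ b y) i) ⟩
  convolve (λ a → ∂ a x) (λ b → ∂ b y) i ∎
  where open ≋R

-- 𝔹_m through F_{1^i}^⊥

sumTo : ℕ → (ℕ → Lin) → Lin
sumTo zero f = []
sumTo (suc n) f = f 0 ++ sumTo n (λ i → f (suc i))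

Σ-applyUpTo : ∀ (f : ℕ → Lin) g n → Σ (map f (applyUpTo g n)) ≡ sumTo n (λ i → f (g i))
Σ-applyUpTo f g zero = refl
Σ-applyUpTo f g (suc n) = cong (f (g 0) ++_) (Σ-applyUpTo f (λ i → g (suc i)) n)

Σ-upTo : ∀ (f : ℕ → Lin) n → Σ (map f (upTo n)) ≡ sumTo n f
Σ-upTo f n = Σ-applyUpTo f (λ i → i) n

sumTo-cong : ∀ n {f g} → (∀ i → f i ≋ g i) → sumTo n f ≋ sumTo n g
sumTo-cong zero p = ≋-refl
sumTo-cong (suc n) p = ++-cong (p 0) (sumTo-cong n (λ i → p (suc i)))

sumTo-++ : ∀ n f g → sumTo n (λ i → f i ++ g i) ≋ sumTo n f ++ sumTo n g
sumTo-++ zero f g = ≋-refl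
sumTo-++ (suc n) f g = ≋-trans (++-congʳ (f 0 ++ g 0) (sumTo-++ n (λ i → f (suc i)) (λ i → g (suc i)))) (++-interchange (f 0) (g 0) _ _)

sumTo-+ : ∀ a b f → sumTo (a ℕ.+ b) f ≡ sumTo a f ++ sumTo b (λ i → f (a ℕ.+ i))
sumTo-+ zero b f = refl
sumTo-+ (suc a) b f = trans (cong (f 0 ++_) (sumTo-+ a b (λ i → f (suc i)))) (sym (LP.++-assoc (f 0) _ _))

sumTo-zero : ∀ n f → (∀ i → f i ≋ []) → sumTo n f ≋ []
sumTo-zero zero f p = ≋-refl
sumTo-zero (suc n) f p = ≋-trans (++-cong (p 0) (sumTo-zero n (λ i → f (suc i)) (λ i → p (suc i)))) ≋-refl

sumTo-scale : ∀ n c f → sumTo n (λ i → scale c (f i)) ≋ scale c (sumTo n f)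
sumTo-scale zero c f = ≋-refl
sumTo-scale (suc n) c f = ≋-trans (++-congʳ _ (sumTo-scale n c (λ i → f (suc i)))) (≡⇒≋ (sym (scale-++ c (f 0) _)))

sumTo-· : ∀ n f y → sumTo n f · y ≡ sumTo n (λ i → f i · y)
sumTo-· zero f y = refl
sumTo-· (suc n) f y = trans (·-++ˡ (f 0) _ y) (cong (f 0 · y ++_) (sumTo-· n (λ i → f (suc i)) y))

sumTo-extend : ∀ n (h : ℕ → List ℕ → Lin) x → extend (λ α → sumTo n (λ i → h i α)) x ≋ sumTo n (λ i → extend (h i) x)
sumTo-extend zero h x = extend-zero x
sumTo-extend (suc n) h x = ≋-trans (extend-pointwise-++ (h 0) _ x) (++-congʳ _ (sumTo-extend n (λ i → h (suc i)) x))

sumTo-trailingZeros : ∀ n N f → (∀ i → n ≤ i → f i ≋ []) → n ≤ N → sumTo N f ≋ sumTo n f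
sumTo-trailingZeros n N f p le = begin
  sumTo N f ≡⟨ cong (λ z → sumTo z f) (sym (ℕP.m+[n∸m]≡n le)) ⟩
  sumTo (n ℕ.+ (N ∸ n)) f ≡⟨ sumTo-+ n (N ∸ n) f ⟩
  sumTo n f ++ sumTo (N ∸ n) (λ i → f (n ℕ.+ i)) ≈⟨ ++-congʳ (sumTo n f) (sumTo-zero (N ∸ n) _ (λ i → p (n ℕ.+ i) (ℕP.m≤m+n n i))) ⟩
  sumTo n f ++ [] ≈⟨ ++-identityʳ-≋ _ ⟩
  sumTo n f ∎
  where open ≋R

sumTo-zero< : ∀ n f → (∀ i → i < n → f i ≋ []) → sumTo n f ≋ []
sumTo-zero< zero f p = ≋-refl
sumTo-zero< (suc n) f p = ≋-trans (++-cong (p 0 (s≤s z≤n)) (sumTo-zero< n (λ i → f (suc i)) (λ i lt → p (suc i) (s≤s lt)))) ≋-refl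

sumTo-snoc : ∀ n f → sumTo (suc n) f ≡ sumTo n f ++ (f n ++ [])
sumTo-snoc zero f = refl
sumTo-snoc (suc n) f = trans (cong (f 0 ++_) (sumTo-snoc n (λ i → f (suc i)))) (sym (LP.++-assoc (f 0) _ _))

sumTo-cong< : ∀ n {f g} → (∀ i → i < n → f i ≋ g i) → sumTo n f ≋ sumTo n g
sumTo-cong< zero p = ≋-refl
sumTo-cong< (suc n) p = ++-cong (p 0 (s≤s z≤n)) (sumTo-cong< n (λ i lt → p (suc i) (s≤s lt)))

extend-pointwise-support : ∀ {f g} x → All (λ α → f α ≋ g α) (support x) → extend f x ≋ extend g x
extend-pointwise-support [] [] = ≋-refl
extend-pointwise-support ((c , α) ∷ x) (p ∷ ps) = ++-cong (scale-cong c p) (extend-pointwise-support x ps)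

Hmul-prepend : ∀ n x → Hmul (+ suc n) x ≡ prepend (suc n) x
Hmul-prepend n [] = refl
Hmul-prepend n ((c , w) ∷ x) = cong (_ ∷_) (Hmul-prepend n x)

Hmul-cong : ∀ m {x y} → x ≋ y → Hmul m x ≋ Hmul m y
Hmul-cong (+ zero) p = p
Hmul-cong (+ suc n) {x} {y} p = ≋-trans (≡⇒≋ (Hmul-prepend n x)) (≋-trans (mapWords-cong _ p) (≡⇒≋ (sym (Hmul-prepend n y))))
Hmul-cong -[1+ n ] p = ≋-refl

Hmul-++ : ∀ m x y → Hmul m (x ++ y) ≡ Hmul m x ++ Hmul m y
Hmul-++ (+ zero) x y = refl
Hmul-++ (+ suc n) x y = LP.map-++ _ x y
Hmul-++ -[1+ n ] x y = refl

Hmul-scale : ∀ m c x → Hmul m (scale c x) ≡ scale c (Hmul m x)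
Hmul-scale (+ zero) c x = refl
Hmul-scale (+ suc n) c [] = refl
Hmul-scale (+ suc n) c ((d , w) ∷ x) = cong (_ ∷_) (Hmul-scale (+ suc n) c x)
Hmul-scale -[1+ n ] c x = refl

Hmul-· : ∀ m x y → Hmul m x · y ≋ Hmul m (x · y)
Hmul-· (+ zero) x y = ≋-refl
Hmul-· (+ suc n) x y = ≋-trans (·-cong (≡⇒≋ (Hmul-prepend n x)) ≋-refl) (≋-trans (≡⇒≋ (prepend-· (suc n) x y)) (≡⇒≋ (sym (Hmul-prepend n (x · y)))))
Hmul-· -[1+ n ] x y = ≋-refl

Hmul-[] : ∀ m → Hmul m [] ≡ []
Hmul-[] (+ zero) = refl
Hmul-[] (+ suc n) = refl
Hmul-[] -[1+ n ] = refl

Hmul-extend : ∀ m f x → Hmul m (extend f x) ≋ extend (λ α → Hmul m (f α)) x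
Hmul-extend m f [] = ≡⇒≋ (Hmul-[] m)
Hmul-extend m f ((c , α) ∷ x) = ≋-trans (≡⇒≋ (trans (Hmul-++ m (scale c (f α)) (extend f x)) (cong (_++ _) (Hmul-scale m c (f α)))))
  (++-congʳ _ (Hmul-extend m f x))

All-unsatisfiable⇒[] : ∀ {A : Set} {P : A → Set} {L : List A} → All P L → (∀ {w} → ¬ P w) → L ≡ []
All-unsatisfiable⇒[] [] n = refl
All-unsatisfiable⇒[] (p ∷ ps) n = ⊥-elim (n p)

lowerings-tooMany : ∀ i α → weight α < i → lowerings i α ≡ []
lowerings-tooMany i α lt = All-unsatisfiable⇒[] (lowerings-sound i α) (λ {w} → λ { (p , e) → ℕP.<⇒≱ lt (subst (i ≤_) e (ℕP.m≤n+m i (weight w))) })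

bTerm : ℤ → ℕ → Lin → Lin
bTerm m i X = scale (sgn i) (Hmul (m ℤ.+ + i) X)

bTerm-cong : ∀ m i {x y} → x ≋ y → bTerm m i x ≋ bTerm m i y
bTerm-cong m i p = scale-cong (sgn i) (Hmul-cong (m ℤ.+ + i) p)

bTerm-zero : ∀ m i → bTerm m i [] ≡ []
bTerm-zero m i = cong (scale (sgn i)) (Hmul-[] (m ℤ.+ + i))

𝔹-extend : ∀ m x → 𝔹 m x ≡ extend (BBasis m) x
𝔹-extend m [] = refl
𝔹-extend m ((c , α) ∷ x) = cong (scale c (BBasis m α) ++_) (𝔹-extend m x)

BBasis-expand : ∀ m α N → weight α < N → BBasis m α ≋ sumTo N (λ i → bTerm m i (loweringsLin i α))
BBasis-expand m α N lt = begin
  BBasis m α ≡⟨ Σ-upTo _ (suc (weight α)) ⟩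
  sumTo (suc (weight α)) (λ i → bTerm m i (perp i (F (replicate i 1)) ((1ℚ , α) ∷ [])))
    ≈⟨ sumTo-cong (suc (weight α)) (λ i → bTerm-cong m i (perp-ones i α)) ⟩
  sumTo (suc (weight α)) (λ i → bTerm m i (loweringsLin i α))
    ≈⟨ ≋-sym (sumTo-trailingZeros (suc (weight α)) N _ (λ i le → ≡⇒≋ (trans (cong (λ z → bTerm m i (fromWords z)) (lowerings-tooMany i α le)) (bTerm-zero m i))) lt) ⟩
  sumTo N (λ i → bTerm m i (loweringsLin i α)) ∎
  where open ≋R

extend-bTerm : ∀ m i x → extend (λ α → bTerm m i (loweringsLin i α)) x ≋ bTerm m i (∂ i x)
extend-bTerm m i x = ≋-trans (extend-pointwise-scale (sgn i) _ x) (scale-cong (sgn i) (≋-sym (Hmul-extend (m ℤ.+ + i) (loweringsLin i) x)))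

WeightsBelow : ℕ → Lin → Set
WeightsBelow N x = All (λ α → weight α < N) (support x)

𝔹-expand : ∀ m G N → WeightsBelow N G → 𝔹 m G ≋ sumTo N (λ i → bTerm m i (∂ i G))
𝔹-expand m G N b = begin
  𝔹 m G ≡⟨ 𝔹-extend m G ⟩
  extend (BBasis m) G ≈⟨ extend-pointwise-support G (All.map (λ {α} lt → BBasis-expand m α N lt) b) ⟩
  extend (λ α → sumTo N (λ i → bTerm m i (loweringsLin i α))) G ≈⟨ sumTo-extend N (λ i α → bTerm m i (loweringsLin i α)) G ⟩
  sumTo N (λ i → extend (λ α → bTerm m i (loweringsLin i α)) G) ≈⟨ sumTo-cong N (λ i → extend-bTerm m i G) ⟩
  sumTo N (λ i → bTerm m i (∂ i G)) ∎
  where open ≋R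

𝔹-cong : ∀ m {x y} → x ≋ y → 𝔹 m x ≋ 𝔹 m y
𝔹-cong m {x} {y} p = ≋-trans (≡⇒≋ (𝔹-extend m x)) (≋-trans (extend-cong _ p) (≡⇒≋ (sym (𝔹-extend m y))))

𝔹-++ : ∀ m x y → 𝔹 m (x ++ y) ≡ 𝔹 m x ++ 𝔹 m y
𝔹-++ m x y = trans (𝔹-extend m (x ++ y)) (trans (extend-++ _ x y) (sym (cong₂ _++_ (𝔹-extend m x) (𝔹-extend m y))))

maxWeight : Lin → ℕ
maxWeight [] = 0
maxWeight ((c , α) ∷ x) = weight α ℕ.⊔ maxWeight x

WeightsBelow-maxWeight : ∀ x → WeightsBelow (suc (maxWeight x)) x
WeightsBelow-maxWeight [] = []
WeightsBelow-maxWeight ((c , α) ∷ x) =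
  s≤s (ℕP.m≤m⊔n (weight α) (maxWeight x)) ∷ All.map (λ lt → ℕP.<-≤-trans lt (s≤s (ℕP.m≤n⊔m (weight α) (maxWeight x)))) (WeightsBelow-maxWeight x)

-- Commuting 𝔹_m with a right factor

sgn-cases : ∀ a → (sgn a ≡ 1ℚ) ⊎ (sgn a ≡ -q 1ℚ)
sgn-cases zero = inj₁ refl
sgn-cases (suc a) with sgn-cases a
... | inj₁ e = inj₂ (cong -q_ e)
... | inj₂ e = inj₁ (cong -q_ e)

sgn-sq : ∀ a → sgn a *q sgn a ≡ 1ℚ
sgn-sq a with sgn-cases a
... | inj₁ e rewrite e = refl
... | inj₂ e rewrite e = refl

sgn-+ : ∀ a b → sgn (a ℕ.+ b) ≡ sgn a *q sgn b
sgn-+ zero b = sym (QP.*-identityˡ (sgn b))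
sgn-+ (suc a) b = trans (cong -q_ (sgn-+ a b)) (QP.neg-distribˡ-* (sgn a) (sgn b))

single : ℕ → Lin → ℕ → Lin
single zero Y zero = Y
single zero Y (suc b) = []
single (suc k) Y zero = []
single (suc k) Y (suc b) = single k Y b

shiftedMul : (ℕ → Lin) → ℕ → Lin → ℕ → Lin
shiftedMul f zero Y i = f i · Y
shiftedMul f (suc k) Y zero = []
shiftedMul f (suc k) Y (suc i) = shiftedMul f k Y i

shiftedMul-unfold : ∀ f k Y i → shiftedMul f k Y i ≋ f 0 · single k Y i ++ shiftedMul (λ a → f (suc a)) (suc k) Y i
shiftedMul-unfold f zero Y zero = ≋-sym (++-identityʳ-≋ _)
shiftedMul-unfold f zero Y (suc i) = ≡⇒≋ (sym (cong (_++ (f (suc i) · Y)) (·-[]ʳ (f 0))))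
shiftedMul-unfold f (suc k) Y zero = ≡⇒≋ (sym (cong (_++ []) (·-[]ʳ (f 0))))
shiftedMul-unfold f (suc k) Y (suc i) = shiftedMul-unfold f k Y i

convolve-single : ∀ f k Y i → convolve f (single k Y) i ≋ shiftedMul f k Y i
convolve-single f zero Y zero = ≋-refl
convolve-single f (suc k) Y zero = ≡⇒≋ (·-[]ʳ (f 0))
convolve-single f zero Y (suc i) = ++-cong {f 0 · []} {[]} (≡⇒≋ (·-[]ʳ (f 0))) (convolve-single (λ a → f (suc a)) zero Y i)
convolve-single f (suc k) Y (suc i) = ≋-trans (++-congʳ _ (convolve-single (λ a → f (suc a)) (suc k) Y i)) (≋-sym (shiftedMul-unfold f k Y i))

shiftedMul-below : ∀ f k Y i → i < k → shiftedMul f k Y i ≡ []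
shiftedMul-below f (suc k) Y zero lt = refl
shiftedMul-below f (suc k) Y (suc i) (s≤s lt) = shiftedMul-below f k Y i lt

shiftedMul-at : ∀ f k Y j → shiftedMul f k Y (k ℕ.+ j) ≡ f j · Y
shiftedMul-at f zero Y j = refl
shiftedMul-at f (suc k) Y j = shiftedMul-at f k Y j

WeightsBelow-· : ∀ N k x y → WeightsBelow N x → All (λ w → weight w ≤ k) (support y) → WeightsBelow (N ℕ.+ k) (x · y)
WeightsBelow-· N k [] y [] by = []
WeightsBelow-· N k ((c , u) ∷ x) y (bu ∷ bx) by = subst (WeightsBelow (N ℕ.+ k)) (sym (·-++ˡ ((c , u) ∷ []) x y))
    (subst (All _) (sym (LP.map-++ proj₂ (((c , u) ∷ []) · y) (x · y))) (AllP.++⁺ (row y by) (WeightsBelow-· N k x y bx by)))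
  where
  row : ∀ y → All (λ w → weight w ≤ k) (support y) → WeightsBelow (N ℕ.+ k) (((c , u) ∷ []) · y)
  row [] [] = []
  row ((d , v) ∷ y) (bv ∷ b) = subst (_< N ℕ.+ k) (sym (sum-++ u v)) (ℕP.+-mono-<-≤ bu bv) ∷ row y b

∂-tooMany : ∀ N G i → WeightsBelow N G → N ≤ i → ∂ i G ≋ []
∂-tooMany N G i b le = ≋-trans (extend-pointwise-support G (All.map (λ {α} lt → ≡⇒≋ (cong fromWords (lowerings-tooMany i α (ℕP.<-≤-trans lt le)))) b)) (extend-zero G)

bTerm-· : ∀ m i X y → bTerm m i X · y ≋ bTerm m i (X · y)
bTerm-· m i X y = ≋-trans (·-scaleˡ (sgn i) (Hmul (m ℤ.+ + i) X) y) (scale-cong (sgn i) (Hmul-· (m ℤ.+ + i) X y))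

bTerm-++ : ∀ m i X X' → bTerm m i (X ++ X') ≡ bTerm m i X ++ bTerm m i X'
bTerm-++ m i X X' = trans (cong (scale (sgn i)) (Hmul-++ (m ℤ.+ + i) X X')) (scale-++ (sgn i) (Hmul (m ℤ.+ + i) X) (Hmul (m ℤ.+ + i) X'))

-- If ∂_b Y vanishes except at b = 0 (where it is Y) and b = k (where it is the scalar c), the
-- Leibniz rule splits 𝔹_m (G Y) into 𝔹_m G · Y and the terms i ≥ k, which reassemble to −𝔹_{m+k} G.
module RightMultiplication (k : ℕ) (Y : Lin) (c : ℚ)
  (sgn-c : ∀ j → sgn (k ℕ.+ j) *q c ≡ -q sgn j)
  (Y-weights : All (λ w → weight w ≤ k) (support Y))
  (∂-Y : ∀ b → ∂ b Y ≋ single 0 Y b ++ single k (scale c oneN) b) where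

  open ≋R

  ∂-·Y : ∀ G i → ∂ i (G · Y) ≋ ∂ i G · Y ++ shiftedMul (λ a → ∂ a G) k (scale c oneN) i
  ∂-·Y G i = begin
    ∂ i (G · Y)                                                  ≈⟨ ∂-· G Y i ⟩
    convolve f (λ b → ∂ b Y) i                                   ≈⟨ convolve-cong (λ a → ≋-refl) ∂-Y i ⟩
    convolve f (λ b → single 0 Y b ++ single k (scale c oneN) b) i ≈⟨ convolve-++ʳ f (single 0 Y) (single k (scale c oneN)) i ⟩
    convolve f (single 0 Y) i ++ convolve f (single k (scale c oneN)) i
      ≈⟨ ++-cong (convolve-single f 0 Y i) (convolve-single f k (scale c oneN) i) ⟩
    ∂ i G · Y ++ shiftedMul f k (scale c oneN) i                 ∎
    where f = λ a → ∂ a G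

  bTerm-shift : ∀ m j X → bTerm m (k ℕ.+ j) (X · scale c oneN) ≋ scale (-q 1ℚ) (bTerm (m ℤ.+ + k) j X)
  bTerm-shift m j X = begin
    scale (sgn (k ℕ.+ j)) (Hmul (m ℤ.+ + (k ℕ.+ j)) (X · scale c oneN))
      ≈⟨ scale-cong (sgn (k ℕ.+ j)) (Hmul-cong (m ℤ.+ + (k ℕ.+ j)) (≋-trans (·-scaleʳ c X oneN) (scale-cong c (·-identityʳ X)))) ⟩
    scale (sgn (k ℕ.+ j)) (Hmul (m ℤ.+ + (k ℕ.+ j)) (scale c X))
      ≡⟨ cong (scale (sgn (k ℕ.+ j))) (trans (cong (λ z → Hmul z (scale c X)) (sym (ℤP.+-assoc m (+ k) (+ j)))) (Hmul-scale m+k+j c X)) ⟩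
    scale (sgn (k ℕ.+ j)) (scale c (Hmul m+k+j X))     ≈⟨ scale-scale (sgn (k ℕ.+ j)) c (Hmul m+k+j X) ⟩
    scale (sgn (k ℕ.+ j) *q c) (Hmul m+k+j X)
     
       ≡⟨ cong (λ z → scale z (Hmul m+k+j X)) (trans (sgn-c j) (trans (cong -q_ (sym (QP.*-identityˡ (sgn j)))) (QP.neg-distribˡ-* 1ℚ (sgn j)))) ⟩
    scale (-q 1ℚ *q sgn j) (Hmul m+k+j X)              ≈⟨ ≋-sym (scale-scale (-q 1ℚ) (sgn j) (Hmul m+k+j X)) ⟩
    scale (-q 1ℚ) (bTerm (m ℤ.+ + k) j X)              ∎
    where m+k+j = (m ℤ.+ + k) ℤ.+ + j

  𝔹-·Y-expand : ∀ m G N → WeightsBelow N G → 𝔹 m G · Y ≋ sumTo N (λ i → bTerm m i (∂ i G · Y))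
  𝔹-·Y-expand m G N bG = begin
    𝔹 m G · Y                                 ≈⟨ ·-cong (𝔹-expand m G N bG) (≋-refl {Y}) ⟩
    sumTo N (λ i → bTerm m i (∂ i G)) · Y     ≡⟨ sumTo-· N (λ i → bTerm m i (∂ i G)) Y ⟩
    sumTo N (λ i → bTerm m i (∂ i G) · Y)     ≈⟨ sumTo-cong N (λ i → bTerm-· m i (∂ i G) Y) ⟩
    sumTo N (λ i → bTerm m i (∂ i G · Y))     ∎

  𝔹-shifted : ∀ m G N → WeightsBelow N G →
    sumTo (k ℕ.+ N) (λ i → bTerm m i (shiftedMul (λ a → ∂ a G) k (scale c oneN) i)) ≋ scale (-q 1ℚ) (𝔹 (m ℤ.+ + k) G)
  𝔹-shifted m G N bG = begin
    sumTo (k ℕ.+ N) g                          ≡⟨ sumTo-+ k N g ⟩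
    sumTo k g ++ sumTo N (λ j → g (k ℕ.+ j))
      ≈⟨ ++-congˡ _ (sumTo-zero< k g (λ i lt → ≡⇒≋ (trans (cong (bTerm m i) (shiftedMul-below f k Z i lt)) (bTerm-zero m i)))) ⟩
    sumTo N (λ j → g (k ℕ.+ j))
      ≈⟨ sumTo-cong N (λ j → ≋-trans (≡⇒≋ (cong (bTerm m (k ℕ.+ j)) (shiftedMul-at f k Z j))) (bTerm-shift m j (f j))) ⟩
    sumTo N (λ j → scale (-q 1ℚ) (bTerm (m ℤ.+ + k) j (∂ j G)))  ≈⟨ sumTo-scale N (-q 1ℚ) (λ j → bTerm (m ℤ.+ + k) j (∂ j G)) ⟩
    scale (-q 1ℚ) (sumTo N (λ j → bTerm (m ℤ.+ + k) j (∂ j G)))  ≈⟨ scale-cong (-q 1ℚ) (≋-sym (𝔹-expand (m ℤ.+ + k) G N bG)) ⟩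
    scale (-q 1ℚ) (𝔹 (m ℤ.+ + k) G)                             ∎
    where
    f = λ a → ∂ a G
    Z = scale c oneN
    g = λ i → bTerm m i (shiftedMul f k Z i)

  𝔹-· : ∀ m G → 𝔹 m G · Y ≋ 𝔹 m (G · Y) ++ 𝔹 (m ℤ.+ + k) G
  𝔹-· m G = ≋-sym (≋-moveʳ (𝔹 m (G · Y)) (𝔹 m G · Y) (𝔹 (m ℤ.+ + k) G) (begin
    𝔹 m (G · Y)                               
      ≈⟨ 𝔹-expand m (G · Y) (k ℕ.+ N) (subst (λ n → WeightsBelow n (G · Y)) (ℕP.+-comm N k) (WeightsBelow-· N k G Y bG Y-weights)) ⟩
    sumTo (k ℕ.+ N) (λ i → bTerm m i (∂ i (G · Y)))
      ≈⟨ sumTo-cong (k ℕ.+ N) (λ i → ≋-trans (bTerm-cong m i (∂-·Y G i)) (≡⇒≋ (bTerm-++ m i (∂ i G · Y) (shiftedMul f k Z i)))) ⟩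
    sumTo (k ℕ.+ N) (λ i → bTerm m i (∂ i G · Y) ++ bTerm m i (shiftedMul f k Z i))
      ≈⟨ sumTo-++ (k ℕ.+ N) (λ i → bTerm m i (∂ i G · Y)) (λ i → bTerm m i (shiftedMul f k Z i)) ⟩
    sumTo (k ℕ.+ N) (λ i → bTerm m i (∂ i G · Y)) ++ sumTo (k ℕ.+ N) (λ i → bTerm m i (shiftedMul f k Z i))
      ≈⟨ ++-cong (≋-trans (sumTo-trailingZeros N (k ℕ.+ N) _ vanish (ℕP.m≤n+m N k)) (≋-sym (𝔹-·Y-expand m G N bG))) (𝔹-shifted m G N bG) ⟩
    𝔹 m G · Y ++ scale (-q 1ℚ) (𝔹 (m ℤ.+ + k) G) ∎))
    where
    N = suc (maxWeight G)
    bG = WeightsBelow-maxWeight G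
    f = λ a → ∂ a G
    Z = scale c oneN
    vanish : ∀ i → N ≤ i → bTerm m i (∂ i G · Y) ≋ []
    vanish i le = ≋-trans (bTerm-cong m i (·-cong (∂-tooMany N G i bG le) (≋-refl {Y}))) (≡⇒≋ (bTerm-zero m i))

-- Iterating the commutation over α

sumFin : ∀ n → (Fin n → Lin) → Lin
sumFin zero f = []
sumFin (suc n) f = f zero ++ sumFin n (λ i → f (suc i))

Σ-allFin : ∀ n (f : Fin n → Lin) → Σ (map f (allFin n)) ≡ sumFin n f
Σ-allFin n f = trans (cong Σ (LP.map-tabulate (λ i → i) f)) (Σ-tabulate n f)
  where
  Σ-tabulate : ∀ n (f : Fin n → Lin) → Σ (tabulate f) ≡ sumFin n f
  Σ-tabulate zero f = refl
  Σ-tabulate (suc n) f = cong (f zero ++_) (Σ-tabulate n (λ i → f (suc i)))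

𝔹-sumFin : ∀ m n f → 𝔹 m (sumFin n f) ≡ sumFin n (λ i → 𝔹 m (f i))
𝔹-sumFin m zero f = refl
𝔹-sumFin m (suc n) f = trans (𝔹-++ m (f zero) _) (cong (𝔹 m (f zero) ++_) (𝔹-sumFin m n (λ i → f (suc i))))

𝔹-sumTo : ∀ m n f → 𝔹 m (sumTo n f) ≡ sumTo n (λ i → 𝔹 m (f i))
𝔹-sumTo m zero f = refl
𝔹-sumTo m (suc n) f = trans (𝔹-++ m (f 0) _) (cong (𝔹 m (f 0) ++_) (𝔹-sumTo m n (λ i → f (suc i))))

module Expansion (k : ℕ) (Y : Lin)
  (𝔹-·Y : ∀ m G → 𝔹 m G · Y ≋ 𝔹 m (G · Y) ++ 𝔹 (m ℤ.+ + k) G)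
  (one·Y : oneN · Y ≋ sumTo k (λ j → 𝔖 (replicate j (+ 0) ++ (+ k ∷ [])))) where

  open ≋R

  raiseOne : List ℕ → Lin
  raiseOne α = sumFin (length α) (λ j → 𝔖 (toℤ (updateAt α j (λ a → a + k))))

  appendK : List ℕ → Lin
  appendK α = sumTo k (λ j → 𝔖 (toℤ α ++ replicate j (+ 0) ++ (+ k ∷ [])))

  𝔖-· : ∀ α → 𝔖 (toℤ α) · Y ≋ raiseOne α ++ appendK α
  𝔖-· [] = one·Y
  𝔖-· (a ∷ α) = begin
    𝔹 (+ a) (𝔖 (toℤ α)) · Y                                 ≈⟨ 𝔹-·Y (+ a) (𝔖 (toℤ α)) ⟩
    𝔹 (+ a) (𝔖 (toℤ α) · Y) ++ 𝔖 (+ (a + k) ∷ toℤ α)       ≈⟨ ++-congˡ _ (𝔹-cong (+ a) (𝔖-· α)) ⟩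
    𝔹 (+ a) (raiseOne α ++ appendK α) ++ 𝔖 (+ (a + k) ∷ toℤ α)
      ≡⟨ cong (_++ 𝔖 (+ (a + k) ∷ toℤ α)) (trans (𝔹-++ (+ a) (raiseOne α) (appendK α))
                                                 (cong₂ _++_ (𝔹-sumFin (+ a) (length α) _) (𝔹-sumTo (+ a) k _))) ⟩
    (raised ++ appendK (a ∷ α)) ++ 𝔖 (+ (a + k) ∷ toℤ α)     ≈⟨ ++-comm≋ (raised ++ appendK (a ∷ α)) _ ⟩
    𝔖 (+ (a + k) ∷ toℤ α) ++ (raised ++ appendK (a ∷ α))     ≈⟨ ≋-sym (++-assoc≋ (𝔖 (+ (a + k) ∷ toℤ α)) raised _) ⟩
    raiseOne (a ∷ α) ++ appendK (a ∷ α)                      ∎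
    where raised = sumFin (length α) (λ j → 𝔹 (+ a) (𝔖 (toℤ (updateAt α j (λ a → a + k)))))

-- Signed elementary functions and hooks

-- (−1)^p e_p
Λ : ℕ → Lin
Λ p = map (λ δ → (sgn (length δ) , δ)) (comps p)

H : ℕ → Lin
H zero = oneN
H (suc n) = (1ℚ , suc n ∷ []) ∷ []

incHeads : Lin → Lin
incHeads = mapWords incHead

negate : Lin → Lin
negate = map (λ { (c , w) → (-q c , w) })

negate-scale : ∀ x → negate x ≋ scale (-q 1ℚ) x
negate-scale [] = ≋-refl
negate-scale ((c , w) ∷ x) = ++-cong {(-q c , w) ∷ []} {(-q 1ℚ *q c , w) ∷ []} (singleton-cong w (trans (cong -q_ (sym (QP.*-identityˡ c))) (QP.neg-distribˡ-* 1ℚ c))) (negate-scale x)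

negate-cong : ∀ {x y} → x ≋ y → negate x ≋ negate y
negate-cong {x} {y} p = ≋-trans (negate-scale x) (≋-trans (scale-cong (-q 1ℚ) p) (≋-sym (negate-scale y)))

negate-++ : ∀ x y → negate (x ++ y) ≡ negate x ++ negate y
negate-++ x y = LP.map-++ _ x y

negate-inverseˡ : ∀ x → negate x ++ x ≋ []
negate-inverseˡ x = ≋-trans (++-comm≋ (negate x) x) (≋-trans (++-congʳ x (negate-scale x)) (++-inverseʳ x))

negate-involutive : ∀ x → negate (negate x) ≋ x
negate-involutive [] = ≋-refl
negate-involutive ((c , w) ∷ x) = ++-cong {(-q (-q c) , w) ∷ []} {(c , w) ∷ []} (singleton-cong w (neg-involutive c)) (negate-involutive x)

negate-· : ∀ x y → negate x · y ≋ negate (x · y)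
negate-· x y = ≋-trans (·-cong {negate x} {scale (-q 1ℚ) x} {y} {y} (negate-scale x) ≋-refl) (≋-trans (·-scaleˡ (-q 1ℚ) x y) (≋-sym (negate-scale (x · y))))

negate-sumTo : ∀ n f → negate (sumTo n f) ≡ sumTo n (λ i → negate (f i))
negate-sumTo zero f = refl
negate-sumTo (suc n) f = trans (negate-++ (f 0) _) (cong (negate (f 0) ++_) (negate-sumTo n (λ i → f (suc i))))

incHeads-cong : ∀ {x y} → x ≋ y → incHeads x ≋ incHeads y
incHeads-cong = mapWords-cong incHead

Φ : Lin → Lin
Φ X = negate (prepend 1 X) ++ incHeads X

Φ-cong : ∀ {x y} → x ≋ y → Φ x ≋ Φ y
Φ-cong p = ++-cong (negate-cong (mapWords-cong _ p)) (incHeads-cong p)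

Φ-++ : ∀ x y → Φ (x ++ y) ≋ Φ x ++ Φ y
Φ-++ x y = ≋-trans (≡⇒≋ (cong₂ _++_ (trans (cong negate (mapWords-++ (1 ∷_) x y)) (negate-++ (prepend 1 x) (prepend 1 y))) (mapWords-++ incHead x y)))
  (++-interchange (negate (prepend 1 x)) _ _ _)

Φ-sumTo : ∀ n f → Φ (sumTo n f) ≋ sumTo n (λ i → Φ (f i))
Φ-sumTo zero f = ≋-refl
Φ-sumTo (suc n) f = ≋-trans (Φ-++ (f 0) _) (++-congʳ _ (Φ-sumTo n (λ i → f (suc i))))

data NonEmpty : List ℕ → Set where
  nonEmpty : ∀ {a w} → NonEmpty (a ∷ w)

incHeads-· : ∀ x y → All NonEmpty (support x) → incHeads (x · y) ≡ incHeads x · y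
incHeads-· [] y [] = refl
incHeads-· ((c , (a ∷ u)) ∷ x) y (nonEmpty ∷ ps) = trans (mapWords-++ incHead _ (x · y)) (cong₂ _++_ (row y) (incHeads-· x y ps))
  where
  row : ∀ y → incHeads (map (λ { (d , v) → (c *q d , (a ∷ u) ++ v) }) y) ≡ map (λ { (d , v) → (c *q d , (suc a ∷ u) ++ v) }) y
  row [] = refl
  row ((d , v) ∷ y) = cong (_ ∷_) (row y)

Φ-· : ∀ x y → All NonEmpty (support x) → Φ (x · y) ≋ Φ x · y
Φ-· x y ps = begin
  negate (prepend 1 (x · y)) ++ incHeads (x · y) ≈⟨ ++-cong (negate-cong (≡⇒≋ (sym (prepend-· 1 x y)))) (≡⇒≋ (incHeads-· x y ps)) ⟩
  negate (prepend 1 x · y) ++ incHeads x · y ≈⟨ ++-congˡ _ (≋-sym (negate-· (prepend 1 x) y)) ⟩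
  negate (prepend 1 x) · y ++ incHeads x · y ≈⟨ ≡⇒≋ (sym (·-++ˡ (negate (prepend 1 x)) (incHeads x) y)) ⟩
  Φ x · y ∎
  where open ≋R

Λ-suc : ∀ p → Λ (suc (suc p)) ≡ Φ (Λ (suc p))
Λ-suc p = trans (LP.map-++ _ (map (1 ∷_) C) (map incHead C)) (cong₂ _++_ (prepend-1 C) (incHead-part C))
  where
  C = comps (suc p)
  prepend-1 : ∀ C → map (λ δ → (sgn (length δ) , δ)) (map (1 ∷_) C) ≡ negate (prepend 1 (map (λ δ → (sgn (length δ) , δ)) C))
  prepend-1 [] = refl
  prepend-1 (δ ∷ C) = cong (_ ∷_) (prepend-1 C)
  incHead-part : ∀ C → map (λ δ → (sgn (length δ) , δ)) (map incHead C) ≡ incHeads (map (λ δ → (sgn (length δ) , δ)) C)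
  incHead-part [] = refl
  incHead-part ([] ∷ C) = cong (_ ∷_) (incHead-part C)
  incHead-part ((x ∷ δ) ∷ C) = cong (_ ∷_) (incHead-part C)

Λ-nonEmpty : ∀ p → All NonEmpty (support (Λ (suc p)))
Λ-nonEmpty p = signedComps (comps (suc p)) (comps-sound (suc p))
  where
  signedComps : ∀ C → All (λ β → isCompositionOf (suc p) β ≡ true) C → All NonEmpty (support (map (λ δ → (sgn (length δ) , δ)) C))
  signedComps [] [] = []
  signedComps ((x ∷ δ) ∷ C) (e ∷ es) = nonEmpty ∷ signedComps C es

-- Σ_{p≤j} Λ_p H_{t−p}; it is both (−1)^j R_{(1^j,t−j)} (R-hook) and 𝔖_{(0^j,t)} (𝔖-zeros).
hook : ℕ → ℕ → Lin
hook j t = sumTo (suc j) (λ p → Λ p · H (t ∸ p))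

Φ-H : ∀ t → Φ (H (suc t)) ≋ Λ 0 · H (suc (suc t)) ++ Λ 1 · H (suc t)
Φ-H t = ++-comm≋ ((-q 1ℚ , 1 ∷ suc t ∷ []) ∷ []) _

Φ-hook : ∀ t j → Φ (hook j (suc t)) ≋ hook (suc j) (suc (suc t))
Φ-hook t j = begin
  Φ (hook j (suc t)) ≈⟨ Φ-sumTo (suc j) (λ p → Λ p · H (suc t ∸ p)) ⟩
  Φ (Λ 0 · H (suc t)) ++ sumTo j (λ p → Φ (Λ (suc p) · H (t ∸ p)))
    ≈⟨ ++-cong (≋-trans (Φ-cong (·-identityˡ (H (suc t)))) (Φ-H t))
               (sumTo-cong j (λ p → ≋-trans (Φ-· (Λ (suc p)) (H (t ∸ p)) (Λ-nonEmpty p)) (·-cong (≡⇒≋ (sym (Λ-suc p))) ≋-refl))) ⟩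
  (Λ 0 · H (suc (suc t)) ++ Λ 1 · H (suc t)) ++ sumTo j (λ p → Λ (suc (suc p)) · H (t ∸ p))
    ≈⟨ ++-assoc≋ (Λ 0 · H (suc (suc t))) (Λ 1 · H (suc t)) _ ⟩
  hook (suc j) (suc (suc t)) ∎
  where open ≋R

ΛH-vanish : ∀ n → hook (suc n) (suc n) ≋ []
ΛH-vanish zero = begin
  Λ 0 · H 1 ++ (Λ 1 · H 0 ++ []) ≈⟨ ++-cong (·-identityˡ (H 1)) (≋-trans (++-identityʳ-≋ _) (·-identityʳ (Λ 1))) ⟩
  H 1 ++ negate (H 1) ≈⟨ ++-comm≋ (H 1) _ ⟩
  negate (H 1) ++ H 1 ≈⟨ negate-inverseˡ (H 1) ⟩
  [] ∎
  where open ≋R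
ΛH-vanish (suc n) = ≋-trans (≋-sym (Φ-hook n (suc n))) (≋-trans (Φ-cong (ΛH-vanish n)) ≋-refl)

HΛ : ℕ → Lin
HΛ p = sumTo (suc p) (λ i → Hmul (+ i) (Λ (p ∸ i)))

incHeads-Hmul : ∀ i x → incHeads (Hmul (+ suc i) x) ≡ Hmul (+ suc (suc i)) x
incHeads-Hmul i [] = refl
incHeads-Hmul i ((c , w) ∷ x) = cong (_ ∷_) (incHeads-Hmul i x)

incHeads-sumTo : ∀ n f → incHeads (sumTo n f) ≡ sumTo n (λ i → incHeads (f i))
incHeads-sumTo zero f = refl
incHeads-sumTo (suc n) f = trans (mapWords-++ incHead (f 0) _) (cong (incHeads (f 0) ++_) (incHeads-sumTo n (λ i → f (suc i))))

HΛ-suc : ∀ p → HΛ (suc (suc p)) ≋ incHeads (HΛ (suc p))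
HΛ-suc p = begin
  Λ (suc (suc p)) ++ (Hmul (+ 1) (Λ (suc p)) ++ shifted) ≡⟨ cong (λ z → z ++ (Hmul (+ 1) (Λ (suc p)) ++ shifted)) (Λ-suc p) ⟩
  (negate (prepend 1 (Λ (suc p))) ++ incHeads (Λ (suc p))) ++ (Hmul (+ 1) (Λ (suc p)) ++ shifted)
    ≈⟨ ++-interchange (negate (prepend 1 (Λ (suc p)))) _ _ _ ⟩
  (negate (prepend 1 (Λ (suc p))) ++ Hmul (+ 1) (Λ (suc p))) ++ (incHeads (Λ (suc p)) ++ shifted)
    ≈⟨ ++-congˡ _ (≋-trans (++-congʳ _ (≡⇒≋ (Hmul-prepend 0 (Λ (suc p))))) (negate-inverseˡ (prepend 1 (Λ (suc p))))) ⟩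
  incHeads (Λ (suc p)) ++ shifted
    ≈⟨ ++-congʳ (incHeads (Λ (suc p))) (≋-trans (sumTo-cong (suc p) (λ i → ≡⇒≋ (sym (incHeads-Hmul i (Λ (p ∸ i))))))
                                               (≡⇒≋ (sym (incHeads-sumTo (suc p) (λ i → Hmul (+ suc i) (Λ (p ∸ i))))))) ⟩
  incHeads (Λ (suc p)) ++ incHeads (sumTo (suc p) (λ i → Hmul (+ suc i) (Λ (p ∸ i)))) ≡⟨ sym (mapWords-++ incHead (Λ (suc p)) _) ⟩
  incHeads (HΛ (suc p)) ∎
  where
  open ≋R
  shifted = sumTo (suc p) (λ i → Hmul (+ suc (suc i)) (Λ (p ∸ i)))

HΛ-vanish : ∀ p → HΛ (suc p) ≋ []
HΛ-vanish zero = begin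
  Λ 1 ++ (Hmul (+ 1) (Λ 0) ++ []) ≈⟨ ++-congʳ (Λ 1) (++-identityʳ-≋ (H 1)) ⟩
  negate (H 1) ++ H 1 ≈⟨ negate-inverseˡ (H 1) ⟩
  [] ∎
  where open ≋R
HΛ-vanish (suc p) = ≋-trans (HΛ-suc p) (≋-trans (incHeads-cong (HΛ-vanish p)) ≋-refl)

++≋[]⇒≋negate : ∀ x y → x ++ y ≋ [] → x ≋ negate y
++≋[]⇒≋negate x y p = begin
  x ≈⟨ ≋-sym (++-identityʳ-≋ x) ⟩
  x ++ [] ≈⟨ ++-congʳ x (≋-sym (negate-inverseˡ y)) ⟩
  x ++ (negate y ++ y) ≈⟨ ++-congʳ x (++-comm≋ (negate y) y) ⟩
  x ++ (y ++ negate y) ≈⟨ ≋-sym (++-assoc≋ x y (negate y)) ⟩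
  (x ++ y) ++ negate y ≈⟨ ++-congˡ (negate y) p ⟩
  negate y ∎
  where open ≋R

-- F_{1^i}^⊥ on Λ and on ψ

∂-cong : ∀ b {x y} → x ≋ y → ∂ b x ≋ ∂ b y
∂-cong b p = extend-cong (loweringsLin b) p

∂-negate : ∀ b x → ∂ b (negate x) ≋ negate (∂ b x)
∂-negate b x = ≋-trans (∂-cong b (negate-scale x)) (≋-trans (extend-scale (loweringsLin b) (-q 1ℚ) x) (≋-sym (negate-scale (∂ b x))))

∂-sumTo : ∀ b n f → ∂ b (sumTo n f) ≡ sumTo n (λ i → ∂ b (f i))
∂-sumTo b zero f = refl
∂-sumTo b (suc n) f = trans (extend-++ (loweringsLin b) (f 0) _) (cong (∂ b (f 0) ++_) (∂-sumTo b n (λ i → f (suc i))))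

∂-one : ∀ b → ∂ b oneN ≋ single 0 oneN b
∂-one zero = ≋-trans (++-identityʳ-≋ _) (scale-1 _)
∂-one (suc b) = ≋-refl

∂-H : ∀ n b → ∂ b (H (suc n)) ≋ single 0 (H (suc n)) b ++ single 1 (H n) b
∂-H n zero = ≋-trans (++-identityʳ-≋ _) (≋-trans (scale-1 _) (≋-sym (++-identityʳ-≋ _)))
∂-H zero (suc zero) = ≋-trans (++-identityʳ-≋ _) (scale-1 _)
∂-H (suc n) (suc zero) = ≋-trans (++-identityʳ-≋ _) (scale-1 _)
∂-H zero (suc (suc b)) = ≋-refl
∂-H (suc n) (suc (suc b)) = ≋-refl

shiftedMul-cong : ∀ {f g} k Y i → (∀ a → f a ≋ g a) → shiftedMul f k Y i ≋ shiftedMul g k Y i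
shiftedMul-cong zero Y i p = ·-cong (p i) ≋-refl
shiftedMul-cong (suc k) Y zero p = ≋-refl
shiftedMul-cong (suc k) Y (suc i) p = shiftedMul-cong k Y i p

∂-·H : ∀ X n b → ∂ b (X · H (suc n)) ≋ ∂ b X · H (suc n) ++ shiftedMul (λ a → ∂ a X) 1 (H n) b
∂-·H X n b = begin
  ∂ b (X · H (suc n)) ≈⟨ ∂-· X (H (suc n)) b ⟩
  convolve f (λ c → ∂ c (H (suc n))) b ≈⟨ convolve-cong (λ a → ≋-refl) (∂-H n) b ⟩
  convolve f (λ c → single 0 (H (suc n)) c ++ single 1 (H n) c) b ≈⟨ convolve-++ʳ f (single 0 (H (suc n))) (single 1 (H n)) b ⟩
  convolve f (single 0 (H (suc n))) b ++ convolve f (single 1 (H n)) b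
    ≈⟨ ++-cong (convolve-single f 0 (H (suc n)) b) (convolve-single f 1 (H n) b) ⟩
  ∂ b X · H (suc n) ++ shiftedMul f 1 (H n) b ∎
  where
  open ≋R
  f = λ a → ∂ a X

∂Λ : ℕ → ℕ → Lin
∂Λ zero p = Λ p
∂Λ (suc a) zero = []
∂Λ (suc a) (suc p) = negate (∂Λ a p)

Λ-recurrence : ∀ p → Λ (suc p) ≋ negate (sumTo (suc p) (λ q → Λ q · H (suc p ∸ q)))
Λ-recurrence p = ++≋[]⇒≋negate (Λ (suc p)) (sumTo (suc p) f) (begin
  Λ (suc p) ++ sumTo (suc p) f ≈⟨ ++-comm≋ (Λ (suc p)) _ ⟩
  sumTo (suc p) f ++ Λ (suc p)
    ≈⟨ ++-congʳ (sumTo (suc p) f) (≋-sym (≋-trans (++-identityʳ-≋ _) (≋-trans (≡⇒≋ (cong (λ z → Λ (suc p) · H z) (ℕP.n∸n≡0 p))) (·-identityʳ (Λ (suc p)))))) ⟩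
  sumTo (suc p) f ++ (f (suc p) ++ []) ≡⟨ sym (sumTo-snoc (suc p) f) ⟩
  hook (suc p) (suc p) ≈⟨ ΛH-vanish p ⟩
  [] ∎)
  where
  open ≋R
  f = λ q → Λ q · H (suc p ∸ q)

∂Λ-recurrence : ∀ a p → sumTo (suc p) (λ q → ∂Λ a q · H (suc p ∸ q) ++ shiftedMul (λ a' → ∂Λ a' q) 1 (H (p ∸ q)) a) ≋ negate (∂Λ a (suc p))
∂Λ-recurrence zero p = begin
  sumTo (suc p) (λ q → Λ q · H (suc p ∸ q) ++ []) ≈⟨ sumTo-cong (suc p) (λ q → ++-identityʳ-≋ (Λ q · H (suc p ∸ q))) ⟩
  sumTo (suc p) (λ q → Λ q · H (suc p ∸ q)) ≈⟨ ≋-sym (negate-involutive (sumTo (suc p) (λ q → Λ q · H (suc p ∸ q)))) ⟩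
  negate (negate (sumTo (suc p) (λ q → Λ q · H (suc p ∸ q)))) ≈⟨ negate-cong (≋-sym (Λ-recurrence p)) ⟩
  negate (Λ (suc p)) ∎
  where open ≋R
∂Λ-recurrence (suc a) p = begin
  sumTo (suc p) (λ q → ∂Λ (suc a) q · H (suc p ∸ q) ++ ∂Λ a q · H (p ∸ q))
    ≈⟨ sumTo-++ (suc p) (λ q → ∂Λ (suc a) q · H (suc p ∸ q)) (λ q → ∂Λ a q · H (p ∸ q)) ⟩
  sumTo (suc p) (λ q → ∂Λ (suc a) q · H (suc p ∸ q)) ++ sumTo (suc p) (λ q → ∂Λ a q · H (p ∸ q))
    ≡⟨ cong (sumTo (suc p) (λ q → ∂Λ (suc a) q · H (suc p ∸ q)) ++_) (sumTo-snoc p _) ⟩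
  ([] ++ sumTo p (λ q → negate (∂Λ a q) · H (p ∸ q))) ++ (rest ++ (∂Λ a p · H (p ∸ p) ++ []))
    ≈⟨ ++-cong (≋-trans (sumTo-cong p (λ q → negate-· (∂Λ a q) (H (p ∸ q)))) (≡⇒≋ (sym (negate-sumTo p (λ q → ∂Λ a q · H (p ∸ q))))))
               (++-congʳ rest (≋-trans (++-identityʳ-≋ _) (≋-trans (≡⇒≋ (cong (λ z → ∂Λ a p · H z) (ℕP.n∸n≡0 p))) (·-identityʳ (∂Λ a p))))) ⟩
  negate rest ++ (rest ++ ∂Λ a p) ≈⟨ ≋-sym (++-assoc≋ (negate rest) rest (∂Λ a p)) ⟩
  (negate rest ++ rest) ++ ∂Λ a p ≈⟨ ++-congˡ (∂Λ a p) (negate-inverseˡ rest) ⟩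
  ∂Λ a p ≈⟨ ≋-sym (negate-involutive (∂Λ a p)) ⟩
  negate (negate (∂Λ a p)) ∎
  where
  open ≋R
  rest = sumTo p (λ q → ∂Λ a q · H (p ∸ q))

∂-Λ-upTo : ∀ p → ∀ q → q ≤ p → ∀ a → ∂ a (Λ q) ≋ ∂Λ a q
∂-Λ-upTo p zero le zero = ∂-one 0
∂-Λ-upTo p zero le (suc a) = ∂-one (suc a)
∂-Λ-upTo (suc p) (suc q) (s≤s le) a = begin
  ∂ a (Λ (suc q)) ≈⟨ ∂-cong a (Λ-recurrence q) ⟩
  ∂ a (negate (sumTo (suc q) (λ r → Λ r · H (suc q ∸ r)))) ≈⟨ ∂-negate a (sumTo (suc q) (λ r → Λ r · H (suc q ∸ r))) ⟩
  negate (∂ a (sumTo (suc q) (λ r → Λ r · H (suc q ∸ r)))) ≡⟨ cong negate (∂-sumTo a (suc q) (λ r → Λ r · H (suc q ∸ r))) ⟩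
  negate (sumTo (suc q) (λ r → ∂ a (Λ r · H (suc q ∸ r)))) ≈⟨ negate-cong (sumTo-cong< (suc q) (λ r lt → term r lt)) ⟩
  negate (sumTo (suc q) (λ r → ∂Λ a r · H (suc q ∸ r) ++ shiftedMul (λ a' → ∂Λ a' r) 1 (H (q ∸ r)) a)) ≈⟨ negate-cong (∂Λ-recurrence a q) ⟩
  negate (negate (∂Λ a (suc q))) ≈⟨ negate-involutive (∂Λ a (suc q)) ⟩
  ∂Λ a (suc q) ∎
  where
  open ≋R
  IH : ∀ r → r ≤ q → ∀ a → ∂ a (Λ r) ≋ ∂Λ a r
  IH r le' = ∂-Λ-upTo p r (ℕP.≤-trans le' le)
  term : ∀ r → r < suc q → ∂ a (Λ r · H (suc q ∸ r)) ≋ ∂Λ a r · H (suc q ∸ r) ++ shiftedMul (λ a' → ∂Λ a' r) 1 (H (q ∸ r)) a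
  term r (s≤s lt) rewrite ℕP.+-∸-assoc 1 lt = ≋-trans (∂-·H (Λ r) (q ∸ r) a) (++-cong (·-cong (IH r lt a) ≋-refl) (shiftedMul-cong 1 (H (q ∸ r)) a (λ a' → IH r lt a')))

∂-Λ : ∀ a p → ∂ a (Λ p) ≋ ∂Λ a p
∂-Λ a p = ∂-Λ-upTo p p ℕP.≤-refl a

∂-hook-telescope : ∀ k' b' j → sumTo (suc j) (λ p → ∂Λ (suc b') p · H (suc k' ∸ p) ++ ∂Λ b' p · H (k' ∸ p)) ≋ ∂Λ b' j · H (k' ∸ j)
∂-hook-telescope k' b' zero = ≋-trans (++-identityʳ-≋ _) ≋-refl
∂-hook-telescope k' b' (suc j) = begin
  sumTo (suc (suc j)) g ≡⟨ sumTo-snoc (suc j) g ⟩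
  sumTo (suc j) g ++ (g (suc j) ++ []) ≈⟨ ++-cong (∂-hook-telescope k' b' j) (++-identityʳ-≋ (g (suc j))) ⟩
  last ++ (negate (∂Λ b' j) · H (k' ∸ j) ++ next) ≈⟨ ≋-sym (++-assoc≋ last _ next) ⟩
  (last ++ negate (∂Λ b' j) · H (k' ∸ j)) ++ next
    ≈⟨ ++-congˡ next (≋-trans (++-congʳ last (negate-· (∂Λ b' j) (H (k' ∸ j)))) (≋-trans (++-comm≋ last _) (negate-inverseˡ last))) ⟩
  next ∎
  where
  open ≋R
  g = λ p → ∂Λ (suc b') p · H (suc k' ∸ p) ++ ∂Λ b' p · H (k' ∸ p)
  last = ∂Λ b' j · H (k' ∸ j)
  next = ∂Λ b' (suc j) · H (k' ∸ suc j)

∂-hook : ∀ k' b' j → j ≤ k' → ∂ (suc b') (hook j (suc k')) ≋ ∂Λ b' j · H (k' ∸ j)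
∂-hook k' b' j le = begin
  ∂ (suc b') (hook j (suc k')) ≡⟨ ∂-sumTo (suc b') (suc j) (λ p → Λ p · H (suc k' ∸ p)) ⟩
  sumTo (suc j) (λ p → ∂ (suc b') (Λ p · H (suc k' ∸ p))) ≈⟨ sumTo-cong< (suc j) term ⟩
  sumTo (suc j) (λ p → ∂Λ (suc b') p · H (suc k' ∸ p) ++ ∂Λ b' p · H (k' ∸ p)) ≈⟨ ∂-hook-telescope k' b' j ⟩
  ∂Λ b' j · H (k' ∸ j) ∎
  where
  open ≋R
  term : ∀ p → p < suc j → ∂ (suc b') (Λ p · H (suc k' ∸ p)) ≋ ∂Λ (suc b') p · H (suc k' ∸ p) ++ ∂Λ b' p · H (k' ∸ p)
  term p (s≤s lt) rewrite ℕP.+-∸-assoc 1 (ℕP.≤-trans lt le) =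
    ≋-trans (∂-·H (Λ p) (k' ∸ p) (suc b')) (++-cong (·-cong (∂-Λ (suc b') p) ≋-refl) (·-cong (∂-Λ b' p) ≋-refl))

negate-single : ∀ k Z b → negate (single k Z b) ≡ single k (negate Z) b
negate-single zero Z zero = refl
negate-single zero Z (suc b) = refl
negate-single (suc k) Z zero = refl
negate-single (suc k) Z (suc b) = negate-single k Z b

single-cong : ∀ k {Z Z'} b → Z ≋ Z' → single k Z b ≋ single k Z' b
single-cong zero zero p = p
single-cong zero (suc b) p = ≋-refl
single-cong (suc k) zero p = ≋-refl
single-cong (suc k) (suc b) p = single-cong k b p

negate-scale-one : ∀ c → negate (scale c oneN) ≋ scale (-q c) oneN
negate-scale-one c = singleton-cong [] (trans (cong -q_ (QP.*-identityʳ c)) (sym (QP.*-identityʳ (-q c))))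

∂-hook-sum : ∀ b' k' → sumTo (suc k') (λ j → ∂Λ b' j · H (k' ∸ j)) ≋ single k' (scale (sgn k') oneN) b'
∂-hook-sum zero zero = ≋-trans (++-identityʳ-≋ _) (≋-trans (·-identityˡ oneN) (≋-sym (scale-1 oneN)))
∂-hook-sum zero (suc k') = ΛH-vanish k'
∂-hook-sum (suc b') zero = ≋-refl
∂-hook-sum (suc b') (suc k') = begin
  sumTo (suc k') (λ j → negate (∂Λ b' j) · H (k' ∸ j)) ≈⟨ sumTo-cong (suc k') (λ j → negate-· (∂Λ b' j) (H (k' ∸ j))) ⟩
  sumTo (suc k') (λ j → negate (∂Λ b' j · H (k' ∸ j))) ≡⟨ sym (negate-sumTo (suc k') (λ j → ∂Λ b' j · H (k' ∸ j))) ⟩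
  negate (sumTo (suc k') (λ j → ∂Λ b' j · H (k' ∸ j))) ≈⟨ negate-cong (∂-hook-sum b' k') ⟩
  negate (single k' (scale (sgn k') oneN) b') ≡⟨ negate-single k' _ b' ⟩
  single k' (negate (scale (sgn k') oneN)) b' ≈⟨ single-cong k' b' (negate-scale-one (sgn k')) ⟩
  single k' (scale (sgn (suc k')) oneN) b' ∎
  where open ≋R

ψ : ℕ → Lin
ψ k = sumTo k (λ j → hook j k)

∂-ψ : ∀ k' b → ∂ b (ψ (suc k')) ≋ single 0 (ψ (suc k')) b ++ single (suc k') (scale (sgn k') oneN) b
∂-ψ k' zero = begin
  ∂ 0 (ψ (suc k')) ≡⟨ ∂-sumTo 0 (suc k') (λ j → hook j (suc k')) ⟩
  sumTo (suc k') (λ j → ∂ 0 (hook j (suc k')))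
    ≈⟨ sumTo-cong< (suc k') (λ j lt → ≋-trans (≡⇒≋ (∂-sumTo 0 (suc j) (λ p → Λ p · H (suc k' ∸ p)))) (sumTo-cong< (suc j) (term j lt))) ⟩
  ψ (suc k') ≈⟨ ≋-sym (++-identityʳ-≋ _) ⟩
  ψ (suc k') ++ [] ∎
  where
  open ≋R
  term : ∀ j → j < suc k' → ∀ p → p < suc j → ∂ 0 (Λ p · H (suc k' ∸ p)) ≋ Λ p · H (suc k' ∸ p)
  term j (s≤s lt) p (s≤s lp) rewrite ℕP.+-∸-assoc 1 (ℕP.≤-trans lp lt) =
    ≋-trans (∂-·H (Λ p) (k' ∸ p) 0) (≋-trans (++-identityʳ-≋ _) (·-cong (∂-Λ 0 p) ≋-refl))
∂-ψ k' (suc b') = begin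
  ∂ (suc b') (ψ (suc k')) ≡⟨ ∂-sumTo (suc b') (suc k') (λ j → hook j (suc k')) ⟩
  sumTo (suc k') (λ j → ∂ (suc b') (hook j (suc k'))) ≈⟨ sumTo-cong< (suc k') (λ j lt → ∂-hook k' b' j (ℕP.≤-pred lt)) ⟩
  sumTo (suc k') (λ j → ∂Λ b' j · H (k' ∸ j)) ≈⟨ ∂-hook-sum b' k' ⟩
  single k' (scale (sgn k') oneN) b' ∎
  where open ≋R

sgn-shift : ∀ k' j → sgn (suc k' ℕ.+ j) *q sgn k' ≡ -q sgn j
sgn-shift k' j = begin
  (-q sgn (k' ℕ.+ j)) *q sgn k' ≡⟨ cong (λ z → (-q z) *q sgn k') (sgn-+ k' j) ⟩
  (-q (sgn k' *q sgn j)) *q sgn k' ≡⟨ sym (QP.neg-distribˡ-* (sgn k' *q sgn j) (sgn k')) ⟩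
  -q ((sgn k' *q sgn j) *q sgn k')
    ≡⟨ cong -q_ (trans (cong (_*q sgn k') (QP.*-comm (sgn k') (sgn j))) (QP.*-assoc (sgn j) (sgn k') (sgn k'))) ⟩
  -q (sgn j *q (sgn k' *q sgn k')) ≡⟨ cong (λ z → -q (sgn j *q z)) (sgn-sq k') ⟩
  -q (sgn j *q 1ℚ) ≡⟨ cong -q_ (QP.*-identityʳ (sgn j)) ⟩
  -q sgn j ∎
  where open ≡-Reasoning

-- 𝔖 of (0, …, 0, k)

Homogeneous : ℕ → Lin → Set
Homogeneous n x = All (λ w → weight w ≡ n) (support x)

Homogeneous-++ : ∀ n x y → Homogeneous n x → Homogeneous n y → Homogeneous n (x ++ y)
Homogeneous-++ n x y a b = subst (All _) (sym (LP.map-++ proj₂ x y)) (AllP.++⁺ a b)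

Homogeneous-· : ∀ a b x y → Homogeneous a x → Homogeneous b y → Homogeneous (a ℕ.+ b) (x · y)
Homogeneous-· a b [] y [] wy = []
Homogeneous-· a b ((c , u) ∷ x) y (wu ∷ wx) wy = subst (Homogeneous (a ℕ.+ b)) (sym (·-++ˡ ((c , u) ∷ []) x y))
  (Homogeneous-++ (a ℕ.+ b) (((c , u) ∷ []) · y) (x · y) (row y wy) (Homogeneous-· a b x y wx wy))
  where
  row : ∀ y → Homogeneous b y → Homogeneous (a ℕ.+ b) (((c , u) ∷ []) · y)
  row [] [] = []
  row ((d , v) ∷ y) (wv ∷ w) = trans (sum-++ u v) (cong₂ ℕ._+_ wu wv) ∷ row y w

Homogeneous-sumTo : ∀ m n f → (∀ i → i < n → Homogeneous m (f i)) → Homogeneous m (sumTo n f)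
Homogeneous-sumTo m zero f p = []
Homogeneous-sumTo m (suc n) f p = Homogeneous-++ m (f 0) _ (p 0 (s≤s z≤n)) (Homogeneous-sumTo m n (λ i → f (suc i)) (λ i lt → p (suc i) (s≤s lt)))

Homogeneous-Λ : ∀ p → Homogeneous p (Λ p)
Homogeneous-Λ p = signedComps (comps p) (comps-sound p)
  where
  signedComps : ∀ C → All (λ β → isCompositionOf p β ≡ true) C → Homogeneous p (map (λ δ → (sgn (length δ) , δ)) C)
  signedComps [] [] = []
  signedComps (δ ∷ C) (e ∷ es) = isCompositionOf⇒weight p δ e ∷ signedComps C es

Homogeneous-H : ∀ n → Homogeneous n (H n)
Homogeneous-H zero = refl ∷ []
Homogeneous-H (suc n) = cong suc (ℕP.+-identityʳ n) ∷ []

Homogeneous-hook : ∀ k j → j < k → Homogeneous k (hook j k)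
Homogeneous-hook k j lt = Homogeneous-sumTo k (suc j) _ (λ p lp → subst (λ z → Homogeneous z (Λ p · H (k ∸ p))) (ℕP.m+[n∸m]≡n (ℕP.≤-trans (ℕP.≤-pred lp) (ℕP.<⇒≤ lt)))
  (Homogeneous-· p (k ∸ p) (Λ p) (H (k ∸ p)) (Homogeneous-Λ p) (Homogeneous-H (k ∸ p))))

ψ-weights : ∀ k → All (λ w → weight w ≤ k) (support (ψ k))
ψ-weights k = All.map (λ e → ℕP.≤-reflexive e) (Homogeneous-sumTo k k _ (Homogeneous-hook k))

Λ↓ : ℕ → ℕ → Lin
Λ↓ zero p = Λ p
Λ↓ (suc i) zero = []
Λ↓ (suc i) (suc p) = Λ↓ i p

sgn-∂Λ : ∀ i p → scale (sgn i) (∂Λ i p) ≋ Λ↓ i p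
sgn-∂Λ zero p = scale-1 (Λ p)
sgn-∂Λ (suc i) zero = ≋-refl
sgn-∂Λ (suc i) (suc p) = begin
  scale (-q sgn i) (negate (∂Λ i p)) ≈⟨ scale-cong (-q sgn i) (negate-scale (∂Λ i p)) ⟩
  scale (-q sgn i) (scale (-q 1ℚ) (∂Λ i p)) ≈⟨ scale-scale (-q sgn i) (-q 1ℚ) (∂Λ i p) ⟩
  scale ((-q sgn i) *q (-q 1ℚ)) (∂Λ i p)
    ≡⟨ cong (λ z → scale z (∂Λ i p)) (trans (sym (QP.neg-distribʳ-* (-q sgn i) 1ℚ)) (trans (cong -q_ (QP.*-identityʳ (-q sgn i))) (neg-involutive (sgn i)))) ⟩
  scale (sgn i) (∂Λ i p) ≈⟨ sgn-∂Λ i p ⟩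
  Λ↓ i p ∎
  where
  open ≋R

Λ↓-small : ∀ i p → p < i → Λ↓ i p ≡ []
Λ↓-small (suc i) zero lt = refl
Λ↓-small (suc i) (suc p) (s≤s lt) = Λ↓-small i p lt

Λ↓-large : ∀ i p → i ≤ p → Λ↓ i p ≡ Λ (p ∸ i)
Λ↓-large zero p le = refl
Λ↓-large (suc i) (suc p) (s≤s le) = Λ↓-large i p le

bTerm-∂Λ : ∀ i p → bTerm (+ 0) i (∂Λ i p) ≋ Hmul (+ i) (Λ↓ i p)
bTerm-∂Λ i p = ≋-trans (≡⇒≋ (sym (Hmul-scale (+ i) (sgn i) (∂Λ i p)))) (Hmul-cong (+ i) (sgn-∂Λ i p))

sumTo-HΛ : ∀ p N → suc p ≤ N → sumTo N (λ i → Hmul (+ i) (Λ↓ i p)) ≋ HΛ p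
sumTo-HΛ p N le = begin
  sumTo N (λ i → Hmul (+ i) (Λ↓ i p))
    ≈⟨ sumTo-trailingZeros (suc p) N _ (λ i li → ≡⇒≋ (trans (cong (Hmul (+ i)) (Λ↓-small i p li)) (Hmul-[] (+ i)))) le ⟩
  sumTo (suc p) (λ i → Hmul (+ i) (Λ↓ i p)) ≈⟨ sumTo-cong< (suc p) (λ i li → ≡⇒≋ (cong (Hmul (+ i)) (Λ↓-large i p (ℕP.≤-pred li)))) ⟩
  HΛ p ∎
  where open ≋R

𝔹₀-Λ-head : ∀ p N → suc p ≤ N → sumTo N (λ i → bTerm (+ 0) i (∂Λ i p)) ≋ single 0 oneN p
𝔹₀-Λ-head p N le = ≋-trans (sumTo-cong N (λ i → bTerm-∂Λ i p)) (≋-trans (sumTo-HΛ p N le) (HΛ≋single p))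
  where
  HΛ≋single : ∀ p → HΛ p ≋ single 0 oneN p
  HΛ≋single zero = ++-identityʳ-≋ oneN
  HΛ≋single (suc p) = HΛ-vanish p

𝔹₀-Λ-tail : ∀ p N → suc p ≤ N → sumTo N (λ i → bTerm (+ 0) (suc i) (∂Λ i p)) ≋ Λ (suc p)
𝔹₀-Λ-tail p N le = begin
  sumTo N (λ i → bTerm (+ 0) (suc i) (∂Λ i p)) ≈⟨ sumTo-cong N (λ i → term i) ⟩
  sumTo N (λ i → negate (Hmul (+ suc i) (Λ↓ i p))) ≡⟨ sym (negate-sumTo N _) ⟩
  negate (sumTo N (λ i → Hmul (+ suc i) (Λ↓ i p)))
    ≈⟨ negate-cong (sumTo-trailingZeros (suc p) N _ (λ i li → ≡⇒≋ (cong (Hmul (+ suc i)) (Λ↓-small i p li))) le) ⟩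
  negate (sumTo (suc p) (λ i → Hmul (+ suc i) (Λ↓ i p)))
    ≈⟨ negate-cong (sumTo-cong< (suc p) (λ i li → ≡⇒≋ (cong (Hmul (+ suc i)) (Λ↓-large i p (ℕP.≤-pred li))))) ⟩
  negate (sumTo (suc p) (λ i → Hmul (+ suc i) (Λ (p ∸ i)))) ≈⟨ negate-cong shiftedHΛ≋ ⟩
  negate (negate (Λ (suc p))) ≈⟨ negate-involutive (Λ (suc p)) ⟩
  Λ (suc p) ∎
  where
  open ≋R
  shiftedHΛ = sumTo (suc p) (λ i → Hmul (+ suc i) (Λ (p ∸ i)))
  shiftedHΛ≋ : shiftedHΛ ≋ negate (Λ (suc p))
  shiftedHΛ≋ = ++≋[]⇒≋negate shiftedHΛ (Λ (suc p)) (≋-trans (++-comm≋ shiftedHΛ (Λ (suc p))) (HΛ-vanish p))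
  term : ∀ i → bTerm (+ 0) (suc i) (∂Λ i p) ≋ negate (Hmul (+ suc i) (Λ↓ i p))
  term i = begin
    scale (-q sgn i) (Hmul (+ suc i) (∂Λ i p)) ≡⟨ sym (Hmul-scale (+ suc i) (-q sgn i) (∂Λ i p)) ⟩
    Hmul (+ suc i) (scale (-q sgn i) (∂Λ i p))
      ≈⟨ Hmul-cong (+ suc i) (≋-trans (≡⇒≋ (cong (λ z → scale z (∂Λ i p)) (trans (cong -q_ (sym (QP.*-identityˡ (sgn i)))) (QP.neg-distribˡ-* 1ℚ (sgn i)))))
                                      (≋-trans (≋-sym (scale-scale (-q 1ℚ) (sgn i) (∂Λ i p))) (≋-sym (negate-scale (scale (sgn i) (∂Λ i p)))))) ⟩
    Hmul (+ suc i) (negate (scale (sgn i) (∂Λ i p))) ≈⟨ Hmul-cong (+ suc i) (negate-cong (sgn-∂Λ i p)) ⟩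
    Hmul (+ suc i) (negate (Λ↓ i p)) ≡⟨ Hmul-negate (Λ↓ i p) ⟩
    negate (Hmul (+ suc i) (Λ↓ i p)) ∎
    where
    Hmul-negate : ∀ x → Hmul (+ suc i) (negate x) ≡ negate (Hmul (+ suc i) x)
    Hmul-negate [] = refl
    Hmul-negate ((c , w) ∷ x) = cong (_ ∷_) (Hmul-negate x)

𝔹₀-ΛH : ∀ p n → 𝔹 (+ 0) (Λ p · H (suc n)) ≋ single 0 (H (suc n)) p ++ Λ (suc p) · H n
𝔹₀-ΛH p n = begin
  𝔹 (+ 0) X ≈⟨ 𝔹-expand (+ 0) X N X-weights ⟩
  sumTo N (λ i → bTerm (+ 0) i (∂ i X)) ≈⟨ sumTo-cong N (λ i → bTerm-cong (+ 0) i (∂-ΛH i)) ⟩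
  sumTo N (λ i → bTerm (+ 0) i (∂Λ i p · Hs ++ shiftedMul (λ a → ∂Λ a p) 1 Hs' i))
    ≈⟨ sumTo-cong N (λ i → ≡⇒≋ (bTerm-++ (+ 0) i (∂Λ i p · Hs) (shiftedMul (λ a → ∂Λ a p) 1 Hs' i))) ⟩
  sumTo N (λ i → bTerm (+ 0) i (∂Λ i p · Hs) ++ bTerm (+ 0) i (shiftedMul (λ a → ∂Λ a p) 1 Hs' i))
    ≈⟨ sumTo-++ N (λ i → bTerm (+ 0) i (∂Λ i p · Hs)) (λ i → bTerm (+ 0) i (shiftedMul (λ a → ∂Λ a p) 1 Hs' i)) ⟩
  sumTo N (λ i → bTerm (+ 0) i (∂Λ i p · Hs)) ++ sumTo N (λ i → bTerm (+ 0) i (shiftedMul (λ a → ∂Λ a p) 1 Hs' i)) ≈⟨ ++-cong part1 part2 ⟩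
  single 0 Hs p ++ Λ (suc p) · Hs' ∎
  where
  open ≋R
  Hs = H (suc n)
  Hs' = H n
  X = Λ p · Hs
  N' = p ℕ.+ suc n
  N = suc N'
  X-weights : WeightsBelow N X
  X-weights = All.map (λ e → s≤s (ℕP.≤-reflexive e)) (Homogeneous-· p (suc n) (Λ p) Hs (Homogeneous-Λ p) (Homogeneous-H (suc n)))
  ∂-ΛH : ∀ i → ∂ i X ≋ ∂Λ i p · Hs ++ shiftedMul (λ a → ∂Λ a p) 1 Hs' i
  ∂-ΛH i = ≋-trans (∂-·H (Λ p) n i) (++-cong (·-cong (∂-Λ i p) ≋-refl) (shiftedMul-cong 1 Hs' i (λ a → ∂-Λ a p)))
  le1 : suc p ≤ N
  le1 = s≤s (ℕP.m≤m+n p (suc n))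
  le2 : suc p ≤ N'
  le2 = subst (suc p ≤_) (sym (ℕP.+-suc p n)) (s≤s (ℕP.m≤m+n p n))
  single-· : ∀ p → single 0 oneN p · Hs ≋ single 0 Hs p
  single-· zero = ·-identityˡ Hs
  single-· (suc p) = ≋-refl
  part1 : sumTo N (λ i → bTerm (+ 0) i (∂Λ i p · Hs)) ≋ single 0 Hs p
  part1 = begin
    sumTo N (λ i → bTerm (+ 0) i (∂Λ i p · Hs)) ≈⟨ sumTo-cong N (λ i → ≋-sym (bTerm-· (+ 0) i (∂Λ i p) Hs)) ⟩
    sumTo N (λ i → bTerm (+ 0) i (∂Λ i p) · Hs) ≡⟨ sym (sumTo-· N (λ i → bTerm (+ 0) i (∂Λ i p)) Hs) ⟩
    sumTo N (λ i → bTerm (+ 0) i (∂Λ i p)) · Hs ≈⟨ ·-cong (𝔹₀-Λ-head p N le1) ≋-refl ⟩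
    single 0 oneN p · Hs ≈⟨ single-· p ⟩
    single 0 Hs p ∎
  part2 : sumTo N (λ i → bTerm (+ 0) i (shiftedMul (λ a → ∂Λ a p) 1 Hs' i)) ≋ Λ (suc p) · Hs'
  part2 = begin
    sumTo N' (λ i → bTerm (+ 0) (suc i) (∂Λ i p · Hs')) ≈⟨ sumTo-cong N' (λ i → ≋-sym (bTerm-· (+ 0) (suc i) (∂Λ i p) Hs')) ⟩
    sumTo N' (λ i → bTerm (+ 0) (suc i) (∂Λ i p) · Hs') ≡⟨ sym (sumTo-· N' (λ i → bTerm (+ 0) (suc i) (∂Λ i p)) Hs') ⟩
    sumTo N' (λ i → bTerm (+ 0) (suc i) (∂Λ i p)) · Hs' ≈⟨ ·-cong (𝔹₀-Λ-tail p N' le2) ≋-refl ⟩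
    Λ (suc p) · Hs' ∎

𝔹₀-hook : ∀ k j → j < k → 𝔹 (+ 0) (hook j k) ≋ hook (suc j) k
𝔹₀-hook k j lt = begin
  𝔹 (+ 0) (hook j k) ≡⟨ 𝔹-sumTo (+ 0) (suc j) (λ p → Λ p · H (k ∸ p)) ⟩
  sumTo (suc j) (λ p → 𝔹 (+ 0) (Λ p · H (k ∸ p))) ≈⟨ sumTo-cong< (suc j) term ⟩
  sumTo (suc j) (λ p → single 0 (H (k ∸ p)) p ++ Λ (suc p) · H (k ∸ suc p))
    ≈⟨ sumTo-++ (suc j) (λ p → single 0 (H (k ∸ p)) p) (λ p → Λ (suc p) · H (k ∸ suc p)) ⟩
  (H k ++ sumTo j (λ p → [])) ++ sumTo (suc j) (λ p → Λ (suc p) · H (k ∸ suc p))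
    ≈⟨ ++-congˡ _ (≋-trans (++-congʳ (H k) (sumTo-zero j (λ p → []) (λ p → ≋-refl))) (≋-trans (++-identityʳ-≋ (H k)) (≋-sym (·-identityˡ (H k))))) ⟩
  hook (suc j) k ∎
  where
  open ≋R
  term : ∀ p → p < suc j → 𝔹 (+ 0) (Λ p · H (k ∸ p)) ≋ single 0 (H (k ∸ p)) p ++ Λ (suc p) · H (k ∸ suc p)
  term p (s≤s lp) rewrite ℕP.+-∸-assoc 1 (ℕP.≤-<-trans lp lt) = 𝔹₀-ΛH p (k ∸ suc p)

𝔹-one : ∀ k → 𝔹 (+ k) oneN ≋ H k
𝔹-one k = begin
  scale 1ℚ (BBasis (+ k) []) ++ [] ≈⟨ ≋-trans (++-identityʳ-≋ _) (scale-1 _) ⟩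
  BBasis (+ k) [] ≈⟨ BBasis-expand (+ k) [] 1 (s≤s z≤n) ⟩
  scale 1ℚ (Hmul (+ (k ℕ.+ 0)) oneN) ++ [] ≈⟨ ≋-trans (++-identityʳ-≋ _) (scale-1 _) ⟩
  Hmul (+ (k ℕ.+ 0)) oneN ≡⟨ cong (λ z → Hmul (+ z) oneN) (ℕP.+-identityʳ k) ⟩
  Hmul (+ k) oneN ≡⟨ Hmul-one k ⟩
  H k ∎
  where
  open ≋R
  Hmul-one : ∀ k → Hmul (+ k) oneN ≡ H k
  Hmul-one zero = refl
  Hmul-one (suc k) = refl

𝔖-zeros : ∀ k j → j < k → 𝔖 (replicate j (+ 0) ++ (+ k ∷ [])) ≋ hook j k
𝔖-zeros k zero lt = ≋-trans (𝔹-one k) (≋-trans (≋-sym (·-identityˡ (H k))) (≋-sym (++-identityʳ-≋ _)))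
𝔖-zeros k (suc j) lt = ≋-trans (𝔹-cong (+ 0) (𝔖-zeros k j (ℕP.<-trans (ℕP.n<1+n j) lt))) (𝔹₀-hook k j (ℕP.<-trans (ℕP.n<1+n j) lt))

-- Ψ_k as a sum of hooks

onesDescents : ℕ → List ℕ
onesDescents zero = []
onesDescents (suc j) = 1 ∷ map suc (onesDescents j)

compsRefining : ℕ → ℕ → List (List ℕ)
compsRefining j t = filterB (λ γ → subsetB (D γ) (onesDescents j)) (comps t)

ribbonSign : List ℕ → ℚ
ribbonSign γ = -q sgn (length γ)

ribbonPart : ℕ → ℕ → Lin
ribbonPart j t = map (λ γ → (ribbonSign γ , γ)) (compsRefining j t)

subset-nil-shift : ∀ Y → subsetB (map suc Y) [] ≡ subsetB Y []
subset-nil-shift [] = refl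
subset-nil-shift (y ∷ Y) = refl

compsRefining-0 : ∀ t → compsRefining 0 (suc (suc t)) ≡ map incHead (compsRefining 0 (suc t))
compsRefining-0 t = begin
  filterB p (map (1 ∷_) C ++ map incHead C) ≡⟨ filterB-++ p (map (1 ∷_) C) (map incHead C) ⟩
  filterB p (map (1 ∷_) C) ++ filterB p (map incHead C) ≡⟨ cong₂ _++_ (filterB-map p (1 ∷_) C) (filterB-map p incHead C) ⟩
  map (1 ∷_) (filterB (λ γ → p (1 ∷ γ)) C) ++ map incHead (filterB (λ γ → p (incHead γ)) C)
   
     ≡⟨ cong₂ (λ u v → map (1 ∷_) u ++ map incHead v) (filterB-none (All.map (λ {γ} → drop-1∷ γ) (comps-sound (suc t))))
                                                       (filterB-cong (All.map (λ {γ} → keep-incHead γ) (comps-sound (suc t)))) ⟩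
  map incHead (compsRefining 0 (suc t)) ∎
  where
  open ≡-Reasoning
  C = comps (suc t)
  p : List ℕ → Bool
  p γ = subsetB (D γ) []
  drop-1∷ : ∀ γ → isCompositionOf (suc t) γ ≡ true → p (1 ∷ γ) ≡ false
  drop-1∷ (suc b ∷ r) e = refl
  keep-incHead : ∀ γ → isCompositionOf (suc t) γ ≡ true → p (incHead γ) ≡ p γ
  keep-incHead (suc b ∷ r) e = trans (cong (λ z → subsetB z []) (D-incHead (suc b) r)) (subset-nil-shift (D (suc b ∷ r)))

compsRefining-suc : ∀ j t → compsRefining (suc j) (suc (suc t)) ≡ map (1 ∷_) (compsRefining j (suc t)) ++ map incHead (compsRefining j (suc t))
compsRefining-suc j t = begin
  filterB p (map (1 ∷_) C ++ map incHead C) ≡⟨ filterB-++ p (map (1 ∷_) C) (map incHead C) ⟩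
  filterB p (map (1 ∷_) C) ++ filterB p (map incHead C) ≡⟨ cong₂ _++_ (filterB-map p (1 ∷_) C) (filterB-map p incHead C) ⟩
  map (1 ∷_) (filterB (λ γ → p (1 ∷ γ)) C) ++ map incHead (filterB (λ γ → p (incHead γ)) C)
   
     ≡⟨ cong₂ (λ u v → map (1 ∷_) u ++ map incHead v) (filterB-cong (All.map (λ {γ} → keep-1∷ γ) (comps-sound (suc t))))
                                                       (filterB-cong (All.map (λ {γ} → keep-incHead γ) (comps-sound (suc t)))) ⟩
  map (1 ∷_) (compsRefining j (suc t)) ++ map incHead (compsRefining j (suc t)) ∎
  where
  open ≡-Reasoning
  C = comps (suc t)
  p : List ℕ → Bool
  p γ = subsetB (D γ) (onesDescents (suc j))
  keep-1∷ : ∀ γ → isCompositionOf (suc t) γ ≡ true → p (1 ∷ γ) ≡ subsetB (D γ) (onesDescents j)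
  keep-1∷ (suc b ∷ r) e = subset-shift (D (suc b ∷ r)) (onesDescents j) (D-positive b r)
  keep-incHead : ∀ γ → isCompositionOf (suc t) γ ≡ true → p (incHead γ) ≡ subsetB (D γ) (onesDescents j)
  keep-incHead (suc b ∷ r) e = trans (cong (λ z → subsetB z (onesDescents (suc j))) (D-incHead (suc b) r)) (subset-shift (D (suc b ∷ r)) (onesDescents j) (D-positive b r))

compsRefining-0-single : ∀ t → compsRefining 0 (suc t) ≡ (suc t ∷ []) ∷ []
compsRefining-0-single zero = refl
compsRefining-0-single (suc t) = trans (compsRefining-0 t) (cong (map incHead) (compsRefining-0-single t))

ribbonPart-0 : ∀ t → ribbonPart 0 (suc t) ≡ H (suc t)
ribbonPart-0 t = cong (map (λ γ → (ribbonSign γ , γ))) (compsRefining-0-single t)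

ribbonPart-suc : ∀ j t → ribbonPart (suc j) (suc (suc t)) ≡ Φ (ribbonPart j (suc t))
ribbonPart-suc j t = trans (cong (map (λ γ → (ribbonSign γ , γ))) (compsRefining-suc j t)) (trans (LP.map-++ _ (map (1 ∷_) C) (map incHead C)) (cong₂ _++_ (prepend-1 C) (incHead-part C)))
  where
  C = compsRefining j (suc t)
  prepend-1 : ∀ C → map (λ γ → (ribbonSign γ , γ)) (map (1 ∷_) C) ≡ negate (prepend 1 (map (λ γ → (ribbonSign γ , γ)) C))
  prepend-1 [] = refl
  prepend-1 (γ ∷ C) = cong (_ ∷_) (prepend-1 C)
  incHead-part : ∀ C → map (λ γ → (ribbonSign γ , γ)) (map incHead C) ≡ incHeads (map (λ γ → (ribbonSign γ , γ)) C)
  incHead-part [] = refl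
  incHead-part ([] ∷ C) = cong (_ ∷_) (incHead-part C)
  incHead-part ((x ∷ γ) ∷ C) = cong (_ ∷_) (incHead-part C)

ribbonPart≋hook : ∀ j t → j < t → ribbonPart j t ≋ hook j t
ribbonPart≋hook zero (suc t) lt = ≋-trans (≡⇒≋ (ribbonPart-0 t)) (≋-trans (≋-sym (·-identityˡ (H (suc t)))) (≋-sym (++-identityʳ-≋ _)))
ribbonPart≋hook (suc j) (suc (suc t)) (s≤s lt) = ≋-trans (≡⇒≋ (ribbonPart-suc j t)) (≋-trans (Φ-cong (ribbonPart≋hook j (suc t) lt)) (Φ-hook t j))

LengthBetween : ℕ → List ℕ → Set
LengthBetween j γ = (1 ≤ length γ) × (length γ ≤ suc j)

length-incHead : ∀ γ → length (incHead γ) ≡ length γ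
length-incHead [] = refl
length-incHead (x ∷ γ) = refl

compsRefining-length : ∀ t j → All (LengthBetween j) (compsRefining j (suc t))
compsRefining-length zero j = (s≤s z≤n , s≤s z≤n) ∷ []
compsRefining-length (suc t) zero = subst (All (LengthBetween 0)) (sym (compsRefining-0 t))
  (AllP.map⁺ (All.map (λ {γ} → λ { (a , b) → subst (λ z → (1 ≤ z) × (z ≤ 1)) (sym (length-incHead γ)) (a , b) }) (compsRefining-length t 0)))
compsRefining-length (suc t) (suc j) = subst (All (LengthBetween (suc j))) (sym (compsRefining-suc j t))
  (AllP.++⁺ (AllP.map⁺ (All.map (λ { (a , b) → s≤s z≤n , s≤s b }) (compsRefining-length t j)))
            (AllP.map⁺ (All.map (λ {γ} → λ { (a , b) → subst (λ z → (1 ≤ z) × (z ≤ suc (suc j))) (sym (length-incHead γ)) (a , ℕP.m≤n⇒m≤1+n b) })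
                                (compsRefining-length t j))))

sgn-length : ∀ i l → 1 ≤ l → l ≤ suc i → sgn i *q sgn (suc i ∸ l) ≡ -q sgn l
sgn-length i (suc zero) le1 le2 = sgn-sq i
sgn-length (suc i) (suc (suc l)) le1 (s≤s le2) = trans (sym (QP.neg-distribˡ-* (sgn i) (sgn (suc i ∸ suc l)))) (cong -q_ (sgn-length i (suc l) (s≤s z≤n) le2))

ribbonOf : ℕ → List ℕ → ℕ → Lin
ribbonOf a X w = map (λ γ → (sgn (a ∸ length γ) , γ)) (filterB (λ γ → subsetB (D γ) X) (comps w))

D-hookShape : ∀ i n → D (replicate i 1 ++ (n ∷ [])) ≡ onesDescents i
D-hookShape zero n = refl
D-hookShape (suc zero) n = refl
D-hookShape (suc (suc i)) n = cong (1 ∷_) (cong (map suc) (D-hookShape (suc i) n))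

length-hookShape : ∀ i n → length (replicate i 1 ++ (n ∷ [])) ≡ suc i
length-hookShape zero n = refl
length-hookShape (suc i) n = cong suc (length-hookShape i n)

weight-hookShape : ∀ i n → weight (replicate i 1 ++ (n ∷ [])) ≡ i + n
weight-hookShape zero n = ℕP.+-identityʳ n
weight-hookShape (suc i) n = cong suc (weight-hookShape i n)

R-hookShape : ∀ i n → R (replicate i 1 ++ (n ∷ [])) ≡ map (λ γ → (sgn (suc i ∸ length γ) , γ)) (compsRefining i (i + n))
R-hookShape i n = trans (cong₂ (λ a X → ribbonOf a X (weight β)) (length-hookShape i n) (D-hookShape i n)) (cong (ribbonOf (suc i) (onesDescents i)) (weight-hookShape i n))
  where
  β = replicate i 1 ++ (n ∷ [])

scale-map : ∀ c (h : List ℕ → ℚ) C → scale c (map (λ γ → (h γ , γ)) C) ≡ map (λ γ → (c *q h γ , γ)) C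
scale-map c h C = sym (LP.map-∘ C)

R-hook : ∀ k i → i < k → scale (sgn i) (R (replicate i 1 ++ (k ∸ i ∷ []))) ≋ ribbonPart i k
R-hook (suc t) i lt = ≡⇒≋ (begin
  scale (sgn i) (R (replicate i 1 ++ (suc t ∸ i ∷ []))) ≡⟨ cong (scale (sgn i)) (R-hookShape i (suc t ∸ i)) ⟩
  scale (sgn i) (map (λ γ → (sgn (suc i ∸ length γ) , γ)) (compsRefining i (i + (suc t ∸ i))))
    ≡⟨ cong (λ z → scale (sgn i) (map (λ γ → (sgn (suc i ∸ length γ) , γ)) (compsRefining i z))) (ℕP.m+[n∸m]≡n (ℕP.<⇒≤ lt)) ⟩
  scale (sgn i) (map (λ γ → (sgn (suc i ∸ length γ) , γ)) (compsRefining i (suc t)))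
    ≡⟨ scale-map (sgn i) (λ γ → sgn (suc i ∸ length γ)) (compsRefining i (suc t)) ⟩
  map (λ γ → (sgn i *q sgn (suc i ∸ length γ) , γ)) (compsRefining i (suc t))
    ≡⟨ LP.map-cong-local (All.map (λ { (a , b) → cong (_, _) (sgn-length i _ a b) }) (compsRefining-length t i)) ⟩
  ribbonPart i (suc t) ∎)
  where open ≡-Reasoning

Ψ≋ψ : ∀ k → Ψ k ≋ ψ k
Ψ≋ψ k = ≋-trans (≡⇒≋ (Σ-upTo _ k)) (sumTo-cong< k (λ i lt → ≋-trans (R-hook k i lt) (ribbonPart≋hook i k lt)))

𝔹-·Ψ : ∀ k m G → 𝔹 m G · Ψ (suc k) ≋ 𝔹 m (G · Ψ (suc k)) ++ 𝔹 (m ℤ.+ + suc k) G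
𝔹-·Ψ k m G = begin
  𝔹 m G · Ψ (suc k)                                ≈⟨ ·-cong (≋-refl {𝔹 m G}) (Ψ≋ψ (suc k)) ⟩
  𝔹 m G · ψ (suc k)                                ≈⟨ 𝔹-· m G ⟩
  𝔹 m (G · ψ (suc k)) ++ 𝔹 (m ℤ.+ + suc k) G      ≈⟨ ++-congˡ _ (𝔹-cong m (·-cong (≋-refl {G}) (≋-sym (Ψ≋ψ (suc k))))) ⟩
  𝔹 m (G · Ψ (suc k)) ++ 𝔹 (m ℤ.+ + suc k) G      ∎
  where
  open ≋R
  open RightMultiplication (suc k) (ψ (suc k)) (sgn k) (sgn-shift k) (ψ-weights (suc k)) (∂-ψ k)

one·Ψ : ∀ k → oneN · Ψ k ≋ sumTo k (λ j → 𝔖 (replicate j (+ 0) ++ (+ k ∷ [])))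
one·Ψ k = ≋-trans (·-identityˡ (Ψ k)) (≋-trans (Ψ≋ψ k) (sumTo-cong< k (λ j lt → ≋-sym (𝔖-zeros k j lt))))

theorem3p27 : (α : List ℕ) → IsComposition α → (k : ℕ) → 0 < k →
    𝔖 (toℤ α) · Ψ k
      ≈ Σ (map (λ j → 𝔖 (toℤ (updateAt α j (λ a → a + k)))) (allFin (length α)))
        ++ Σ (map (λ j → 𝔖 (toℤ α ++ replicate j (+ 0) ++ (+ k ∷ []))) (upTo k))
theorem3p27 α _ (suc k) _ = get (≋-trans (𝔖-· α) (≡⇒≋ (sym (cong₂ _++_ (Σ-allFin (length α) _) (Σ-upTo _ (suc k))))))
  where open Expansion (suc k) (Ψ (suc k)) (𝔹-·Ψ k) (one·Ψ (suc k))
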